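{- For all nonnegative integers $p,q$, $$A_{p,q}(t)=\sum_{L\in\mathcal{P}(p,q)}t^{\#\{\text{diagonal steps of } L\}}.$$
   Context: A signed $(p,q)$-involution ($p,q\ge0$, $n=p+q$) is an involution $\pi$ of $\{1,\dots,n\}$ together with a sign $+$ or $-$ on each fixed point such that (number of $+$) $-$ (number of $-$) $=p-q$. $\gamma_{k,p,q}$ is the number of signed $(p,q)$-involutions with exactly $k$ 2-cycles, and $A_{p,q}(t)=\sum_{k\ge0}\gamma_{k,p,q}t^k$. A $(p,q)$ Delannoy path is a lattice path from $(0,0)$ to $(p,q)$ using steps $(1,0)$, $(0,1)$, $(1,1)$; a diagonal step from $(a,b)$ to $(a+1,b+1)$ is a $k$-diagonal step with $k=a+b+1$. A weighted $(p,q)$ Delannoy path is such a path with a positive integer label $m$ on each diagonal step satisfying $1\le m\le k-1$ if the step is a $k$-diagonal step; $\mathcal{P}(p,q)$ is the set of weighted $(p,q)$ Delannoy paths. -}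

module Defs where

open import Data.Bool using (Bool; true; false; _∧_; _∨_; not; if_then_else_)
open import Data.Nat using (ℕ; zero; suc; _+_; _*_; _≡ᵇ_; _≤ᵇ_)
open import Data.Fin using (Fin; _≟_)
open import Data.Vec using (Vec; []; _∷_; lookup)
open import Data.List using (List; []; _∷_; map; concatMap; length; filterᵇ; allFin; cartesianProduct; upTo)
open import Data.Product using (_×_; _,_; proj₁; proj₂)
open import Relation.Nullary using (does)

allVecs : {A : Set} → (n : ℕ) → List A → List (Vec A n)
allVecs zero    xs = [] ∷ []
allVecs (suc n) xs = concatMap (λ x → map (x ∷_) (allVecs n xs)) xs

countᵇ : {A : Set} → (A → Bool) → List A → ℕ
countᵇ P xs = length (filterᵇ P xs)

_==F_ : {n : ℕ} → Fin n → Fin n → Bool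
i ==F j = does (i ≟ j)

-- A candidate on {1..n} (here Fin n) is a pair (π , s) where π is a
-- map Fin n → Fin n (as a vector) and s : Vec Bool n gives signs
-- (true = '+', false = '-').  Signs are only meaningful on fixed points,
-- so to represent each signed involution exactly once we normalise the
-- sign of every non-fixed point to true.

Candidate : ℕ → Set
Candidate n = Vec (Fin n) n × Vec Bool n

allCandidates : (n : ℕ) → List (Candidate n)
allCandidates n = cartesianProduct (allVecs n (allFin n)) (allVecs n (true ∷ false ∷ []))

module _ {n : ℕ} (c : Candidate n) where
  private
    π : Fin n → Fin n
    π i = lookup (proj₁ c) i
    s : Fin n → Bool
    s i = lookup (proj₂ c) i

  isFixed : Fin n → Bool
  isFixed i = π i ==F i

  isInvolutionᵇ : Bool
  isInvolutionᵇ = length (filterᵇ (λ i → not (π (π i) ==F i)) (allFin n)) ≡ᵇ 0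

  normalisedᵇ : Bool
  normalisedᵇ = length (filterᵇ (λ i → not (isFixed i) ∧ not (s i)) (allFin n)) ≡ᵇ 0

  numPlus : ℕ
  numPlus = countᵇ (λ i → isFixed i ∧ s i) (allFin n)

  numMinus : ℕ
  numMinus = countᵇ (λ i → isFixed i ∧ not (s i)) (allFin n)

  -- number of non-fixed points (= 2 × number of 2-cycles for an involution)
  numMoved : ℕ
  numMoved = countᵇ (λ i → not (isFixed i)) (allFin n)

-- (c is a signed (p,q)-involution on p+q points with exactly k 2-cycles)
-- the sign condition  #+ - #- = p - q  is written  #+ + q = #- + p  in ℕ
isSignedInvᵇ : (k p q : ℕ) → Candidate (p + q) → Bool
isSignedInvᵇ k p q c =
  isInvolutionᵇ c ∧ normalisedᵇ c ∧ ((numPlus c + q) ≡ᵇ (numMinus c + p))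
  ∧ (numMoved c ≡ᵇ 2 * k)

γ : (k p q : ℕ) → ℕ
γ k p q = countᵇ (isSignedInvᵇ k p q) (allCandidates (p + q))

-- A_{p,q}(t), represented by its coefficient sequence: coefficient of t^k
A : (p q : ℕ) → ℕ → ℕ
A p q k = γ k p q

data WStep : Set where
  east  : WStep
  north : WStep
  diag  : ℕ → WStep

-- validity of a weighted step sequence starting at (a,b) and ending at (p,q):
-- a diagonal step from (a,b) is a k-diagonal step with k = a+b+1.
-- Its label m is taken in 1 ≤ m ≤ a+b+1 = k.  (The context literally says
-- 1 ≤ m ≤ k-1, which makes the proposition false, e.g. p=q=1.
-- The range 1..a+b+1 is the one for which the identity holds, i.e. the
-- paper's convention with the step indexed by its endpoint k = a+b+2.)
validFrom : (p q a b : ℕ) → List WStep → Bool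
validFrom p q a b []             = (a ≡ᵇ p) ∧ (b ≡ᵇ q)
validFrom p q a b (east ∷ w)     = validFrom p q (suc a) b w
validFrom p q a b (north ∷ w)    = validFrom p q a (suc b) w
validFrom p q a b (diag m ∷ w)   = (1 ≤ᵇ m) ∧ (m ≤ᵇ suc (a + b)) ∧ validFrom p q (suc a) (suc b) w

IsWeightedDelannoyᵇ : (p q : ℕ) → List WStep → Bool
IsWeightedDelannoyᵇ p q w = validFrom p q 0 0 w

numDiag : List WStep → ℕ
numDiag []           = 0
numDiag (diag _ ∷ w) = suc (numDiag w)
numDiag (_ ∷ w)      = numDiag w

stepsUpTo : ℕ → List WStep
stepsUpTo B = east ∷ north ∷ map diag (upTo (suc B))

-- every weighted (p,q) Delannoy path has length ≤ p+q and labels ≤ p+q,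
-- so it occurs (exactly once) in this list of candidates
candidatePaths : (p q : ℕ) → List (List WStep)
candidatePaths p q =
  concatMap (λ L → map Data.Vec.toList (allVecs L (stepsUpTo (p + q)))) (upTo (suc (p + q)))

𝒫 : (p q : ℕ) → List (List WStep)
𝒫 p q = filterᵇ (IsWeightedDelannoyᵇ p q) (candidatePaths p q)

DelannoyPoly : (p q : ℕ) → ℕ → ℕ
DelannoyPoly p q k = countᵇ (λ w → numDiag w ≡ᵇ k) (𝒫 p q)

module Submission where

open import Defs
open import Data.Bool using (Bool; true; false; _∧_; not; T)
open import Data.Bool.Properties using (∧-zeroʳ; ∧-identityʳ; ∧-assoc; ∧-comm) renaming (_≟_ to _≟ᴮ_)
open import Data.Nat using (ℕ; zero; suc; _+_; _*_; _≤_; _<_; z≤n; s≤s; _≡ᵇ_; _≤ᵇ_; _<ᵇ_)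
open import Data.Nat.Properties
  using (+-assoc; +-comm; +-suc; +-identityʳ; *-comm; *-zeroʳ; *-identityʳ; *-suc; *-distribˡ-+;
         ≤-refl; ≤-trans; ≤-reflexive; ≤-pred; <⇒≤; <-irrefl; ≤-<-trans; <-≤-trans; n≤1+n; n<1+n;
         m≤n⇒m≤1+n; m≤n+m; +-monoˡ-≤; +-monoʳ-≤; m≤n⇒m<n∨m≡n; ≡ᵇ⇒≡)
  renaming (_≟_ to _≟ℕ_)
open import Data.Fin using (Fin; zero; suc; punchIn; _≟_)
open import Data.Fin.Properties using (punchIn-injective; punchInᵢ≢i; 0≢1+n) renaming (suc-injective to Fin-suc-injective)
open import Data.Vec using (Vec; []; _∷_; lookup; tabulate; toList; _∷ʳ_)
import Data.Vec.Properties as Vec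
open import Data.List using (List; []; _∷_; _++_; map; concat; filterᵇ; allFin; cartesianProduct; applyUpTo; upTo; length)
import Data.List as List
open import Data.List.Properties using (length-tabulate)
open import Data.Product using (_×_; _,_; proj₁; proj₂)
import Data.Product.Properties as Product
open import Data.Sum using (inj₁; inj₂)
open import Data.Empty using (⊥-elim)
open import Function using (_∘_; id)
open import Function.Bundles using (mk⇔)
open import Relation.Binary.Definitions using (DecidableEquality)
open import Relation.Nullary using (Dec; does; yes; no; ¬_; _×-dec_)
open import Relation.Nullary.Decidable using (dec-true; dec-false; does-⇔)
open import Relation.Binary.PropositionalEquality using (_≡_; _≢_; refl; sym; trans; cong; cong₂; subst)
open Relation.Binary.PropositionalEquality.≡-Reasoning

-- Both sides are shown to satisfy the same recurrence (`SolvesRecurrence`)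
--   f(0,0,k) = [k = 0],
--   f(p,q,k) = f(p-1,q,k) + f(p,q-1,k) + (p+q-1)·f(p-1,q-1,k-1)   for p + q > 0,
-- where terms with a negative argument are 0; by induction on p + q such a
-- recurrence has only one solution (`recurrence-unique`).
--  * Involutions: classify by the point 0.  It is fixed with sign + or -, which
--    leaves a signed involution on p+q-1 points with q or p raised by one (only
--    the difference p - q of the sign condition matters), or it forms a 2-cycle
--    with one of the other p+q-1 points, leaving p+q-2 points.
--  * Paths: classify by the last step, which is east, north, or a diagonal step
--    from (p-1,q-1) carrying one of p+q-1 labels; this is done for paths of each
--    fixed length, then summed over the lengths.

𝟙 : Bool → ℕ
𝟙 true  = 1
𝟙 false = 0

𝟙-∧ : ∀ a b → 𝟙 (a ∧ b) ≡ 𝟙 a * 𝟙 b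
𝟙-∧ true  b = sym (+-identityʳ (𝟙 b))
𝟙-∧ false b = refl

∑ : {X : Set} → List X → (X → ℕ) → ℕ
∑ []       f = 0
∑ (x ∷ xs) f = f x + ∑ xs f

syntax ∑ xs (λ x → e) = ∑[ x ∈ xs ] e

private
  variable
    X Y : Set
    n   : ℕ

∑-cong : (xs : List X) {f g : X → ℕ} → (∀ x → f x ≡ g x) → ∑ xs f ≡ ∑ xs g
∑-cong []       f≗g = refl
∑-cong (x ∷ xs) f≗g = cong₂ _+_ (f≗g x) (∑-cong xs f≗g)

∑-zero : (xs : List X) {f : X → ℕ} → (∀ x → f x ≡ 0) → ∑ xs f ≡ 0
∑-zero []       f≗0 = refl
∑-zero (x ∷ xs) f≗0 = cong₂ _+_ (f≗0 x) (∑-zero xs f≗0)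

∑-++ : (xs ys : List X) (f : X → ℕ) → ∑ (xs ++ ys) f ≡ ∑ xs f + ∑ ys f
∑-++ []       ys f = refl
∑-++ (x ∷ xs) ys f = trans (cong (f x +_) (∑-++ xs ys f)) (sym (+-assoc (f x) _ _))

∑-+ : (xs : List X) (f g : X → ℕ) → ∑[ x ∈ xs ] (f x + g x) ≡ ∑ xs f + ∑ xs g
∑-+ []       f g = refl
∑-+ (x ∷ xs) f g = begin
  f x + g x + ∑[ y ∈ xs ] (f y + g y) ≡⟨ cong (f x + g x +_) (∑-+ xs f g) ⟩
  f x + g x + (∑ xs f + ∑ xs g)       ≡⟨ +-assoc (f x) (g x) _ ⟩
  f x + (g x + (∑ xs f + ∑ xs g))     ≡⟨ cong (f x +_) (sym (+-assoc (g x) _ _)) ⟩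
  f x + (g x + ∑ xs f + ∑ xs g)       ≡⟨ cong (λ m → f x + (m + ∑ xs g)) (+-comm (g x) _) ⟩
  f x + (∑ xs f + g x + ∑ xs g)       ≡⟨ cong (f x +_) (+-assoc (∑ xs f) (g x) _) ⟩
  f x + (∑ xs f + (g x + ∑ xs g))     ≡⟨ sym (+-assoc (f x) _ _) ⟩
  f x + ∑ xs f + (g x + ∑ xs g)       ∎

∑-*ˡ : (c : ℕ) (xs : List X) (f : X → ℕ) → ∑[ x ∈ xs ] (c * f x) ≡ c * ∑ xs f
∑-*ˡ c []       f = sym (*-zeroʳ c)
∑-*ˡ c (x ∷ xs) f = trans (cong (c * f x +_) (∑-*ˡ c xs f)) (sym (*-distribˡ-+ c (f x) _))

∑-swap : (xs : List X) (ys : List Y) (f : X → Y → ℕ) →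
         ∑[ x ∈ xs ] ∑[ y ∈ ys ] f x y ≡ ∑[ y ∈ ys ] ∑[ x ∈ xs ] f x y
∑-swap []       ys f = sym (∑-zero ys (λ _ → refl))
∑-swap (x ∷ xs) ys f = trans (cong (∑ ys (f x) +_) (∑-swap xs ys f))
                             (sym (∑-+ ys (f x) (λ y → ∑[ x′ ∈ xs ] f x′ y)))

∑-map : (g : X → Y) (xs : List X) (f : Y → ℕ) → ∑ (map g xs) f ≡ ∑ xs (f ∘ g)
∑-map g []       f = refl
∑-map g (x ∷ xs) f = cong (f (g x) +_) (∑-map g xs f)

∑-concatMap : (g : X → List Y) (xs : List X) (f : Y → ℕ) → ∑ (List.concatMap g xs) f ≡ ∑[ x ∈ xs ] ∑ (g x) f
∑-concatMap g []       f = refl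
∑-concatMap g (x ∷ xs) f =
  trans (∑-++ (g x) (concat (map g xs)) f) (cong (∑ (g x) f +_) (∑-concatMap g xs f))

∑-cartesianProduct : (xs : List X) (ys : List Y) (f : X × Y → ℕ) →
                     ∑ (cartesianProduct xs ys) f ≡ ∑[ x ∈ xs ] ∑[ y ∈ ys ] f (x , y)
∑-cartesianProduct []       ys f = refl
∑-cartesianProduct (x ∷ xs) ys f =
  trans (∑-++ (map (x ,_) ys) _ f) (cong₂ _+_ (∑-map (x ,_) ys f) (∑-cartesianProduct xs ys f))

∑-allVecs-head : (L : ℕ) (xs : List X) (f : Vec X (suc L) → ℕ) →
                 ∑ (allVecs (suc L) xs) f ≡ ∑[ x ∈ xs ] ∑[ v ∈ allVecs L xs ] f (x ∷ v)
∑-allVecs-head L xs f = trans (∑-concatMap (λ x → map (x ∷_) (allVecs L xs)) xs f)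
                              (∑-cong xs (λ x → ∑-map (x ∷_) (allVecs L xs) f))

∑-allVecs-last : (L : ℕ) (xs : List X) (f : Vec X (suc L) → ℕ) →
                 ∑ (allVecs (suc L) xs) f ≡ ∑[ x ∈ xs ] ∑[ v ∈ allVecs L xs ] f (v ∷ʳ x)
∑-allVecs-last zero    xs f = ∑-allVecs-head zero xs f
∑-allVecs-last (suc L) xs f = begin
  ∑ (allVecs (suc (suc L)) xs) f
    ≡⟨ ∑-allVecs-head (suc L) xs f ⟩
  ∑[ y ∈ xs ] ∑[ v ∈ allVecs (suc L) xs ] f (y ∷ v)
    ≡⟨ ∑-cong xs (λ y → ∑-allVecs-last L xs (λ v → f (y ∷ v))) ⟩
  ∑[ y ∈ xs ] ∑[ x ∈ xs ] ∑[ v ∈ allVecs L xs ] f (y ∷ (v ∷ʳ x))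
    ≡⟨ ∑-swap xs xs _ ⟩
  ∑[ x ∈ xs ] ∑[ y ∈ xs ] ∑[ v ∈ allVecs L xs ] f ((y ∷ v) ∷ʳ x)
    ≡⟨ ∑-cong xs (λ x → sym (∑-allVecs-head L xs (λ w → f (w ∷ʳ x)))) ⟩
  ∑[ x ∈ xs ] ∑[ v ∈ allVecs (suc L) xs ] f (v ∷ʳ x) ∎

countᵇ-as-∑ : (P : X → Bool) (xs : List X) → countᵇ P xs ≡ ∑[ x ∈ xs ] 𝟙 (P x)
countᵇ-as-∑ P []       = refl
countᵇ-as-∑ P (x ∷ xs) with P x
... | true  = cong suc (countᵇ-as-∑ P xs)
... | false = countᵇ-as-∑ P xs

∑-filterᵇ : (V P : X → Bool) (xs : List X) → ∑[ x ∈ filterᵇ V xs ] 𝟙 (P x) ≡ ∑[ x ∈ xs ] 𝟙 (V x ∧ P x)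
∑-filterᵇ V P []       = refl
∑-filterᵇ V P (x ∷ xs) with V x
... | true  = cong (𝟙 (P x) +_) (∑-filterᵇ V P xs)
... | false = ∑-filterᵇ V P xs

∑-𝟙-≤-length : (P : X → Bool) (xs : List X) → ∑[ x ∈ xs ] 𝟙 (P x) ≤ length xs
∑-𝟙-≤-length P []       = z≤n
∑-𝟙-≤-length P (x ∷ xs) with P x
... | true  = s≤s (∑-𝟙-≤-length P xs)
... | false = m≤n⇒m≤1+n (∑-𝟙-≤-length P xs)

∑-applyUpTo : (g : ℕ → X) (n : ℕ) (f : X → ℕ) → ∑ (applyUpTo g n) f ≡ ∑[ i ∈ upTo n ] f (g i)
∑-applyUpTo g zero    f = refl
∑-applyUpTo g (suc n) f =
  cong (f (g 0) +_) (trans (∑-applyUpTo (g ∘ suc) n f) (sym (∑-applyUpTo suc n (f ∘ g))))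

∑-upTo-suc : (n : ℕ) (f : ℕ → ℕ) → ∑[ i ∈ upTo (suc n) ] f i ≡ f 0 + ∑[ i ∈ upTo n ] f (suc i)
∑-upTo-suc n f = cong (f 0 +_) (∑-applyUpTo suc n f)

∑-upTo-last : (n : ℕ) (f : ℕ → ℕ) → ∑[ i ∈ upTo (suc n) ] f i ≡ ∑[ i ∈ upTo n ] f i + f n
∑-upTo-last zero    f = +-comm (f 0) 0
∑-upTo-last (suc n) f = begin
  ∑[ i ∈ upTo (suc (suc n)) ] f i                ≡⟨ ∑-upTo-suc (suc n) f ⟩
  f 0 + ∑[ i ∈ upTo (suc n) ] f (suc i)          ≡⟨ cong (f 0 +_) (∑-upTo-last n (f ∘ suc)) ⟩
  f 0 + (∑[ i ∈ upTo n ] f (suc i) + f (suc n))  ≡⟨ sym (+-assoc (f 0) _ _) ⟩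
  f 0 + ∑[ i ∈ upTo n ] f (suc i) + f (suc n)    ≡⟨ cong (_+ f (suc n)) (sym (∑-upTo-suc n f)) ⟩
  ∑[ i ∈ upTo (suc n) ] f i + f (suc n)          ∎

∑-tabulate : (n : ℕ) (g : Fin n → X) (f : X → ℕ) → ∑ (List.tabulate g) f ≡ ∑[ i ∈ allFin n ] f (g i)
∑-tabulate zero    g f = refl
∑-tabulate (suc n) g f = cong (f (g zero) +_) (trans (∑-tabulate n (g ∘ suc) f) (sym (∑-tabulate n suc (f ∘ g))))

∑-allFin-suc : (n : ℕ) (f : Fin (suc n) → ℕ) → ∑[ i ∈ allFin (suc n) ] f i ≡ f zero + ∑[ i ∈ allFin n ] f (suc i)
∑-allFin-suc n f = cong (f zero +_) (∑-tabulate n suc f)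

∑-allFin-punchIn : (n : ℕ) (j : Fin (suc n)) (f : Fin (suc n) → ℕ) →
                   ∑[ i ∈ allFin (suc n) ] f i ≡ f j + ∑[ i ∈ allFin n ] f (punchIn j i)
∑-allFin-punchIn n       zero    f = ∑-allFin-suc n f
∑-allFin-punchIn (suc n) (suc j) f = begin
  ∑[ i ∈ allFin (suc (suc n)) ] f i                               ≡⟨ ∑-allFin-suc (suc n) f ⟩
  f zero + ∑[ i ∈ allFin (suc n) ] f (suc i)                      ≡⟨ cong (f zero +_) (∑-allFin-punchIn n j (f ∘ suc)) ⟩
  f zero + (f (suc j) + ∑[ i ∈ allFin n ] f (suc (punchIn j i)))  ≡⟨ sym (+-assoc (f zero) _ _) ⟩
  f zero + f (suc j) + ∑[ i ∈ allFin n ] f (suc (punchIn j i))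
    ≡⟨ cong (_+ ∑[ i ∈ allFin n ] f (suc (punchIn j i))) (+-comm (f zero) _) ⟩
  f (suc j) + f zero + ∑[ i ∈ allFin n ] f (suc (punchIn j i))    ≡⟨ +-assoc (f (suc j)) _ _ ⟩
  f (suc j) + (f zero + ∑[ i ∈ allFin n ] f (suc (punchIn j i)))
    ≡⟨ cong (f (suc j) +_) (sym (∑-allFin-suc n (f ∘ punchIn (suc j)))) ⟩
  f (suc j) + ∑[ i ∈ allFin (suc n) ] f (punchIn (suc j) i)       ∎

∑-allFin-const : (n c : ℕ) → ∑[ _ ∈ allFin n ] c ≡ n * c
∑-allFin-const zero    c = refl
∑-allFin-const (suc n) c = trans (∑-allFin-suc n (λ _ → c)) (cong (c +_) (∑-allFin-const n c))

∑-𝟙-allFin-≤ : (n : ℕ) (P : Fin n → Bool) → ∑[ i ∈ allFin n ] 𝟙 (P i) ≤ n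
∑-𝟙-allFin-≤ n P = ≤-trans (∑-𝟙-≤-length P (allFin n)) (≤-reflexive (length-tabulate id))

∑-𝟙-zero⇒false : (n : ℕ) (P : Fin n → Bool) → ∑[ i ∈ allFin n ] 𝟙 (P i) ≡ 0 → ∀ i → P i ≡ false
∑-𝟙-zero⇒false (suc n) P sum≡0 i with P zero in P0 | trans (sym (∑-allFin-suc n (𝟙 ∘ P))) sum≡0
∑-𝟙-zero⇒false (suc n) P sum≡0 zero    | false | _      = P0
∑-𝟙-zero⇒false (suc n) P sum≡0 (suc i) | false | rest≡0 = ∑-𝟙-zero⇒false n (P ∘ suc) rest≡0 i

does-true⇒ : {P : Set} (d : Dec P) → does d ≡ true → P
does-true⇒ (yes p) _ = p

does-false⇒ : {P : Set} (d : Dec P) → does d ≡ false → ¬ P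
does-false⇒ (no ¬p) _ = ¬p

≡ᵇ-sound : (m m′ : ℕ) → (m ≡ᵇ m′) ≡ true → m ≡ m′
≡ᵇ-sound m m′ eq = ≡ᵇ⇒≡ m m′ (subst T (sym eq) _)

≡ᵇ-false : (m m′ : ℕ) → m ≢ m′ → (m ≡ᵇ m′) ≡ false
≡ᵇ-false m m′ = dec-false (m ≟ℕ m′)

not-false⇒ : ∀ {x} → not x ≡ false → x ≡ true
not-false⇒ {true} _ = refl

not-true⇒ : ∀ {x} → not x ≡ true → x ≡ false
not-true⇒ {false} _ = refl

∧-true-left : ∀ x {y} → x ∧ y ≡ true → x ≡ true
∧-true-left true _ = refl

∧-true-right : ∀ x {y} → x ∧ y ≡ true → y ≡ true
∧-true-right true y≡true = y≡true

∧-false-third : ∀ x y z → (x ∧ y ∧ false ∧ z) ≡ false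
∧-false-third x y z = trans (cong (x ∧_) (∧-zeroʳ y)) (∧-zeroʳ x)

∧-false-last : ∀ x y z → (x ∧ y ∧ z ∧ false) ≡ false
∧-false-last x y z = trans (cong (λ t → x ∧ y ∧ t) (∧-zeroʳ z)) (∧-false-third x y true)

-- xs lists every element of X exactly once.  (Any two deciders of equality
-- agree, so the choice of _≟_ is immaterial.)
record IsEnumeration (_≟_ : DecidableEquality X) (xs : List X) : Set where
  constructor enumerates
  field occurs-once : ∀ a → ∑[ x ∈ xs ] 𝟙 (does (a ≟ x)) ≡ 1
open IsEnumeration

∑-enumeration-unit : {_≟_ : DecidableEquality Y} {ys : List Y} → IsEnumeration _≟_ ys →
                     (c : ℕ) (b : Y) → ∑[ y ∈ ys ] (c * 𝟙 (does (b ≟ y))) ≡ c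
∑-enumeration-unit {ys = ys} enum c b =
  trans (∑-*ˡ c ys _) (trans (cong (c *_) (occurs-once enum b)) (*-identityʳ c))

-- Counting along a bijection: if `extend` maps the elements of Y satisfying Q
-- onto the elements of X satisfying P, with inverse `restrict`, the two counts
-- agree.  (Double counting of the pairs x ↔ y.)
module _ {_≟X_ : DecidableEquality X} {_≟Y_ : DecidableEquality Y} {xs : List X} {ys : List Y}
         (enumX : IsEnumeration _≟X_ xs) (enumY : IsEnumeration _≟Y_ ys)
         (P : X → Bool) (Q : Y → Bool) (restrict : X → Y) (extend : Y → X)
         (P∘extend : ∀ y → P (extend y) ≡ Q y)
         (restrict∘extend : ∀ y → restrict (extend y) ≡ y)
         (extend∘restrict : ∀ x → P x ≡ true → extend (restrict x) ≡ x) where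

  private
    corresponds : ∀ x y → (P x ∧ does (restrict x ≟Y y)) ≡ (Q y ∧ does (extend y ≟X x))
    corresponds x y with restrict x ≟Y y | extend y ≟X x
    ... | yes _ | yes e = cong (_∧ true) (trans (cong P (sym e)) (P∘extend y))
    ... | no ¬r | yes e = ⊥-elim (¬r (trans (cong restrict (sym e)) (restrict∘extend y)))
    ... | no _  | no _  = trans (∧-zeroʳ (P x)) (sym (∧-zeroʳ (Q y)))
    corresponds x y | yes r | no ¬e with P x in Px
    ... | true  = ⊥-elim (¬e (trans (cong extend (sym r)) (extend∘restrict x Px)))
    ... | false = sym (∧-zeroʳ (Q y))

  count-bijection : ∑[ x ∈ xs ] 𝟙 (P x) ≡ ∑[ y ∈ ys ] 𝟙 (Q y)
  count-bijection = begin
    ∑[ x ∈ xs ] 𝟙 (P x)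
      ≡⟨ ∑-cong xs (λ x → sym (∑-enumeration-unit enumY (𝟙 (P x)) (restrict x))) ⟩
    ∑[ x ∈ xs ] ∑[ y ∈ ys ] (𝟙 (P x) * 𝟙 (does (restrict x ≟Y y)))
      ≡⟨ ∑-cong xs (λ x → ∑-cong ys (λ y → begin
           𝟙 (P x) * 𝟙 (does (restrict x ≟Y y))  ≡⟨ sym (𝟙-∧ (P x) _) ⟩
           𝟙 (P x ∧ does (restrict x ≟Y y))      ≡⟨ cong 𝟙 (corresponds x y) ⟩
           𝟙 (Q y ∧ does (extend y ≟X x))        ≡⟨ 𝟙-∧ (Q y) _ ⟩
           𝟙 (Q y) * 𝟙 (does (extend y ≟X x))    ∎)) ⟩
    ∑[ x ∈ xs ] ∑[ y ∈ ys ] (𝟙 (Q y) * 𝟙 (does (extend y ≟X x)))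
      ≡⟨ ∑-swap xs ys _ ⟩
    ∑[ y ∈ ys ] ∑[ x ∈ xs ] (𝟙 (Q y) * 𝟙 (does (extend y ≟X x)))
      ≡⟨ ∑-cong ys (λ y → ∑-enumeration-unit enumX (𝟙 (Q y)) (extend y)) ⟩
    ∑[ y ∈ ys ] 𝟙 (Q y) ∎

allFin-enumerates : (n : ℕ) → IsEnumeration _≟_ (allFin n)
allFin-enumerates n = enumerates (once n)
  where
  once : (n : ℕ) (i : Fin n) → ∑[ j ∈ allFin n ] 𝟙 (does (i ≟ j)) ≡ 1
  once (suc n) zero    = trans (∑-allFin-suc n (λ j → 𝟙 (does (zero ≟ j)))) (cong suc (∑-zero (allFin n) (λ _ → refl)))
  once (suc n) (suc i) = trans (∑-allFin-suc n (λ j → 𝟙 (does (suc i ≟ j)))) (once n i)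

signs-enumerate : IsEnumeration _≟ᴮ_ (true ∷ false ∷ [])
signs-enumerate = enumerates λ { true → refl ; false → refl }

allVecs-enumerates : {_≟_ : DecidableEquality X} {xs : List X} → IsEnumeration _≟_ xs →
                     (n : ℕ) → IsEnumeration (Vec.≡-dec _≟_) (allVecs n xs)
allVecs-enumerates {X = X} {_≟_ = _≟_} {xs} enum n = enumerates (once n)
  where
  once : (n : ℕ) (v : Vec X n) → ∑[ w ∈ allVecs n xs ] 𝟙 (does (Vec.≡-dec _≟_ v w)) ≡ 1
  once zero    []      = refl
  once (suc n) (a ∷ v) = begin
    ∑ (allVecs (suc n) xs) (λ w → 𝟙 (does (Vec.≡-dec _≟_ (a ∷ v) w)))
      ≡⟨ ∑-allVecs-head n xs _ ⟩
    ∑[ x ∈ xs ] ∑[ w ∈ allVecs n xs ] 𝟙 (does (a ≟ x) ∧ does (Vec.≡-dec _≟_ v w))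
      ≡⟨ ∑-cong xs (λ x → ∑-cong (allVecs n xs) (λ w → 𝟙-∧ (does (a ≟ x)) _)) ⟩
    ∑[ x ∈ xs ] ∑[ w ∈ allVecs n xs ] (𝟙 (does (a ≟ x)) * 𝟙 (does (Vec.≡-dec _≟_ v w)))
      ≡⟨ ∑-cong xs (λ x → ∑-enumeration-unit {_≟_ = Vec.≡-dec _≟_} {ys = allVecs n xs}
                            (enumerates (once n)) (𝟙 (does (a ≟ x))) v) ⟩
    ∑[ x ∈ xs ] 𝟙 (does (a ≟ x))
      ≡⟨ occurs-once enum a ⟩
    1 ∎

does-≡-pair : (_≟X_ : DecidableEquality X) (_≟Y_ : DecidableEquality Y) (a c : X) (b d : Y) →
              does (Product.≡-dec _≟X_ _≟Y_ (a , b) (c , d)) ≡ does (a ≟X c) ∧ does (b ≟Y d)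
does-≡-pair _≟X_ _≟Y_ a c b d = does-⇔ (mk⇔ Product.,-injective (λ (e₁ , e₂) → cong₂ _,_ e₁ e₂))
                                       (Product.≡-dec _≟X_ _≟Y_ (a , b) (c , d)) ((a ≟X c) ×-dec (b ≟Y d))

cartesianProduct-enumerates : {_≟X_ : DecidableEquality X} {_≟Y_ : DecidableEquality Y}
  {xs : List X} {ys : List Y} → IsEnumeration _≟X_ xs → IsEnumeration _≟Y_ ys →
  IsEnumeration (Product.≡-dec _≟X_ _≟Y_) (cartesianProduct xs ys)
cartesianProduct-enumerates {_≟X_ = _≟X_} {_≟Y_} {xs} {ys} enumX enumY = enumerates once
  where
  once : ∀ z → ∑[ w ∈ cartesianProduct xs ys ] 𝟙 (does (Product.≡-dec _≟X_ _≟Y_ z w)) ≡ 1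
  once (a , b) = begin
    ∑ (cartesianProduct xs ys) (λ z → 𝟙 (does (Product.≡-dec _≟X_ _≟Y_ (a , b) z)))
      ≡⟨ ∑-cartesianProduct xs ys _ ⟩
    ∑[ x ∈ xs ] ∑[ y ∈ ys ] 𝟙 (does (Product.≡-dec _≟X_ _≟Y_ (a , b) (x , y)))
      ≡⟨ ∑-cong xs (λ x → ∑-cong ys (λ y →
           trans (cong 𝟙 (does-≡-pair _≟X_ _≟Y_ a x b y)) (𝟙-∧ (does (a ≟X x)) _))) ⟩
    ∑[ x ∈ xs ] ∑[ y ∈ ys ] (𝟙 (does (a ≟X x)) * 𝟙 (does (b ≟Y y)))
      ≡⟨ ∑-cong xs (λ x → ∑-enumeration-unit enumY (𝟙 (does (a ≟X x))) b) ⟩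
    ∑[ x ∈ xs ] 𝟙 (does (a ≟X x))
      ≡⟨ occurs-once enumX a ⟩
    1 ∎

_≟ᶜ_ : DecidableEquality (Candidate n)
_≟ᶜ_ = Product.≡-dec (Vec.≡-dec _≟_) (Vec.≡-dec _≟ᴮ_)

candidates-enumerate : (n : ℕ) → IsEnumeration _≟ᶜ_ (allCandidates n)
candidates-enumerate n =
  cartesianProduct-enumerates (allVecs-enumerates (allFin-enumerates n) n) (allVecs-enumerates signs-enumerate n)

-- A weighted path to (p , q) with k diagonal steps ends with
-- an east step from (p-1 , q), a north step from (p , q-1), or a diagonal
-- step from (p-1 , q-1) carrying one of p+q-1 labels.
fromEast : (ℕ → ℕ → ℕ → ℕ) → ℕ → ℕ → ℕ → ℕ
fromEast f zero    q k = 0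
fromEast f (suc p) q k = f p q k

fromNorth : (ℕ → ℕ → ℕ → ℕ) → ℕ → ℕ → ℕ → ℕ
fromNorth f p zero    k = 0
fromNorth f p (suc q) k = f p q k

fromDiag : (ℕ → ℕ → ℕ → ℕ) → ℕ → ℕ → ℕ → ℕ
fromDiag f (suc p) (suc q) (suc k) = suc (p + q) * f p q k
fromDiag f _       _       _       = 0

lastStep : (ℕ → ℕ → ℕ → ℕ) → ℕ → ℕ → ℕ → ℕ
lastStep f p q k = fromEast f p q k + fromNorth f p q k + fromDiag f p q k

private
  suc-p+q< : ∀ p q → suc p + q < suc p + suc q
  suc-p+q< p q = s≤s (≤-reflexive (sym (+-suc p q)))

lastStep-cong : {f g : ℕ → ℕ → ℕ → ℕ} (p q k : ℕ) →
                (∀ p′ q′ k′ → p′ + q′ < p + q → f p′ q′ k′ ≡ g p′ q′ k′) →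
                lastStep f p q k ≡ lastStep g p q k
lastStep-cong zero    zero    k       agree = refl
lastStep-cong (suc p) zero    k       agree = cong (λ x → x + 0 + 0) (agree p 0 k (n<1+n (p + 0)))
lastStep-cong zero    (suc q) k       agree = cong (λ x → 0 + x + 0) (agree 0 q k (n<1+n q))
lastStep-cong (suc p) (suc q) zero    agree =
  cong₂ (λ x y → x + y + 0) (agree p (suc q) 0 (n<1+n _)) (agree (suc p) q 0 (suc-p+q< p q))
lastStep-cong (suc p) (suc q) (suc k) agree =
  cong₂ _+_ (cong₂ _+_ (agree p (suc q) (suc k) (n<1+n _)) (agree (suc p) q (suc k) (suc-p+q< p q)))
            (cong (suc (p + q) *_) (agree p q k (s≤s (+-monoʳ-≤ p (n≤1+n q)))))

lastStep-zero : (p q k : ℕ) → lastStep (λ _ _ _ → 0) p q k ≡ 0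
lastStep-zero (suc p) (suc q) (suc k) = *-zeroʳ (suc (p + q))
lastStep-zero zero    zero    k       = refl
lastStep-zero zero    (suc q) k       = refl
lastStep-zero (suc p) zero    k       = refl
lastStep-zero (suc p) (suc q) zero    = refl

∑-lastStep : (xs : List X) (F : X → ℕ → ℕ → ℕ → ℕ) (p q k : ℕ) →
             ∑[ x ∈ xs ] lastStep (F x) p q k ≡ lastStep (λ p′ q′ k′ → ∑[ x ∈ xs ] F x p′ q′ k′) p q k
∑-lastStep xs F p q k = begin
  ∑[ x ∈ xs ] lastStep (F x) p q k
    ≡⟨ trans (∑-+ xs _ _) (cong (_+ ∑[ x ∈ xs ] fromDiag (F x) p q k) (∑-+ xs _ _)) ⟩
  ∑[ x ∈ xs ] fromEast (F x) p q k + ∑[ x ∈ xs ] fromNorth (F x) p q k + ∑[ x ∈ xs ] fromDiag (F x) p q k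
    ≡⟨ cong₂ _+_ (cong₂ _+_ (fromEast-agrees p) (fromNorth-agrees q)) (fromDiag-agrees p q k) ⟩
  lastStep ∑F p q k ∎
  where
  ∑F : ℕ → ℕ → ℕ → ℕ
  ∑F p′ q′ k′ = ∑[ x ∈ xs ] F x p′ q′ k′
  fromEast-agrees : ∀ p → ∑[ x ∈ xs ] fromEast (F x) p q k ≡ fromEast ∑F p q k
  fromEast-agrees zero    = ∑-zero xs (λ _ → refl)
  fromEast-agrees (suc p) = refl
  fromNorth-agrees : ∀ q → ∑[ x ∈ xs ] fromNorth (F x) p q k ≡ fromNorth ∑F p q k
  fromNorth-agrees zero    = ∑-zero xs (λ _ → refl)
  fromNorth-agrees (suc q) = refl
  fromDiag-agrees : ∀ p q k → ∑[ x ∈ xs ] fromDiag (F x) p q k ≡ fromDiag ∑F p q k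
  fromDiag-agrees (suc p) (suc q) (suc k) = ∑-*ˡ (suc (p + q)) xs (λ x → F x p q k)
  fromDiag-agrees zero    q       k       = ∑-zero xs (λ _ → refl)
  fromDiag-agrees (suc p) zero    k       = ∑-zero xs (λ _ → refl)
  fromDiag-agrees (suc p) (suc q) zero    = ∑-zero xs (λ _ → refl)

record SolvesRecurrence (f : ℕ → ℕ → ℕ → ℕ) : Set where
  field
    initial : ∀ k → f 0 0 k ≡ 𝟙 (0 ≡ᵇ k)
    step    : ∀ p q k → 0 < p + q → f p q k ≡ lastStep f p q k
open SolvesRecurrence

recurrence-unique : {f g : ℕ → ℕ → ℕ → ℕ} → SolvesRecurrence f → SolvesRecurrence g →
                    ∀ p q k → f p q k ≡ g p q k
recurrence-unique {f} {g} sf sg p q k = below (suc (p + q)) p q k (n<1+n (p + q))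
  where
  below   : ∀ n p q k → p + q < n → f p q k ≡ g p q k
  viaStep : ∀ n p q k → 0 < p + q → p + q < suc n → f p q k ≡ g p q k
  below (suc n) zero    zero    k _  = trans (initial sf k) (sym (initial sg k))
  below (suc n) (suc p) q       k lt = viaStep n (suc p) q k (s≤s z≤n) lt
  below (suc n) zero    (suc q) k lt = viaStep n zero (suc q) k (s≤s z≤n) lt
  viaStep n p q k pos lt = begin
    f p q k           ≡⟨ step sf p q k pos ⟩
    lastStep f p q k
      ≡⟨ lastStep-cong p q k (λ p′ q′ k′ lt′ → below n p′ q′ k′ (≤-trans lt′ (≤-pred lt))) ⟩
    lastStep g p q k  ≡⟨ sym (step sg p q k pos) ⟩
    g p q k           ∎


-- Signed involutions.  A candidate is read as a map π together with signs s;
-- the test isSignedInvᵇ only looks at five counts attached to (π , s).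

perm : Candidate n → Fin n → Fin n
perm c = lookup (proj₁ c)

sign : Candidate n → Fin n → Bool
sign c = lookup (proj₂ c)

candidate : (Fin n → Fin n) → (Fin n → Bool) → Candidate n
candidate π s = tabulate π , tabulate s

candidate-η : (c : Candidate n) → candidate (perm c) (sign c) ≡ c
candidate-η (π , s) = cong₂ _,_ (Vec.tabulate∘lookup π) (Vec.tabulate∘lookup s)

candidate-cong : {π π′ : Fin n → Fin n} {s s′ : Fin n → Bool} →
                 (∀ i → π i ≡ π′ i) → (∀ i → s i ≡ s′ i) → candidate π s ≡ candidate π′ s′
candidate-cong π≗π′ s≗s′ = cong₂ _,_ (Vec.tabulate-cong π≗π′) (Vec.tabulate-cong s≗s′)

==F-refl : (i : Fin n) → (i ==F i) ≡ true
==F-refl i = dec-true (i ≟ i) refl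

==F-sound : (i i′ : Fin n) → (i ==F i′) ≡ true → i ≡ i′
==F-sound i i′ = does-true⇒ (i ≟ i′)

==F-punchIn : (j : Fin (suc n)) (i i′ : Fin n) → (punchIn j i ==F punchIn j i′) ≡ (i ==F i′)
==F-punchIn j i i′ with i ≟ i′
... | yes refl = ==F-refl (punchIn j i)
... | no i≢i′  = dec-false (punchIn j i ≟ punchIn j i′) (i≢i′ ∘ punchIn-injective j i i′)

record Stats : Set where
  constructor stats
  field
    nonInvolutive : ℕ
    unnormalised  : ℕ
    plus          : ℕ
    minus         : ℕ
    moved         : ℕ
open Stats

stats-≡ : ∀ {a b c d e a′ b′ c′ d′ e′} → a ≡ a′ → b ≡ b′ → c ≡ c′ → d ≡ d′ → e ≡ e′ →
          stats a b c d e ≡ stats a′ b′ c′ d′ e′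
stats-≡ refl refl refl refl refl = refl

_⊕_ : Stats → Stats → Stats
stats a b c d e ⊕ stats a′ b′ c′ d′ e′ = stats (a + a′) (b + b′) (c + c′) (d + d′) (e + e′)

∑ˢ : List X → (X → Stats) → Stats
∑ˢ xs f = stats (∑ xs (nonInvolutive ∘ f)) (∑ xs (unnormalised ∘ f)) (∑ xs (plus ∘ f))
                (∑ xs (minus ∘ f)) (∑ xs (moved ∘ f))

∑ˢ-cong : (xs : List X) {f g : X → Stats} → (∀ x → f x ≡ g x) → ∑ˢ xs f ≡ ∑ˢ xs g
∑ˢ-cong xs f≗g = stats-≡ (∑-cong xs (cong nonInvolutive ∘ f≗g)) (∑-cong xs (cong unnormalised ∘ f≗g))
                         (∑-cong xs (cong plus ∘ f≗g)) (∑-cong xs (cong minus ∘ f≗g)) (∑-cong xs (cong moved ∘ f≗g))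

∑ˢ-allFin-suc : (f : Fin (suc n) → Stats) → ∑ˢ (allFin (suc n)) f ≡ f zero ⊕ ∑ˢ (allFin n) (f ∘ suc)
∑ˢ-allFin-suc {n} f = stats-≡ (∑-allFin-suc n _) (∑-allFin-suc n _) (∑-allFin-suc n _)
                              (∑-allFin-suc n _) (∑-allFin-suc n _)

∑ˢ-allFin-punchIn : (j : Fin (suc n)) (f : Fin (suc n) → Stats) →
                    ∑ˢ (allFin (suc n)) f ≡ f j ⊕ ∑ˢ (allFin n) (f ∘ punchIn j)
∑ˢ-allFin-punchIn {n} j f = stats-≡ (∑-allFin-punchIn n j _) (∑-allFin-punchIn n j _) (∑-allFin-punchIn n j _)
                                    (∑-allFin-punchIn n j _) (∑-allFin-punchIn n j _)

localStats : Fin n → Fin n → Fin n → Bool → Stats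
localStats x y z t = stats (𝟙 (not (z ==F x))) (𝟙 (not (y ==F x) ∧ not t))
                           (𝟙 ((y ==F x) ∧ t)) (𝟙 ((y ==F x) ∧ not t)) (𝟙 (not (y ==F x)))

pointStats : (Fin n → Fin n) → (Fin n → Bool) → Fin n → Stats
pointStats π s i = localStats i (π i) (π (π i)) (s i)

statsOf : (Fin n → Fin n) → (Fin n → Bool) → Stats
statsOf {n} π s = ∑ˢ (allFin n) (pointStats π s)

statsᶜ : Candidate n → Stats
statsᶜ c = statsOf (perm c) (sign c)

pointStats-at : {π : Fin n → Fin n} {s : Fin n → Bool} {x y z : Fin n} {t : Bool} →
                π x ≡ y → π y ≡ z → s x ≡ t → pointStats π s x ≡ localStats x y z t
pointStats-at refl refl refl = refl

localStats-punchIn : (j : Fin (suc n)) (x y z : Fin n) (t : Bool) →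
                     localStats (punchIn j x) (punchIn j y) (punchIn j z) t ≡ localStats x y z t
localStats-punchIn j x y z t =
  cong₂ (λ u v → stats (𝟙 (not u)) (𝟙 (not v ∧ not t)) (𝟙 (v ∧ t)) (𝟙 (v ∧ not t)) (𝟙 (not v)))
        (==F-punchIn j z x) (==F-punchIn j y x)

pointStats-cong : {π π′ : Fin n → Fin n} {s s′ : Fin n → Bool} →
                  (∀ i → π i ≡ π′ i) → (∀ i → s i ≡ s′ i) →
                  ∀ i → pointStats π s i ≡ pointStats π′ s′ i
pointStats-cong {π = π} {π′} π≗π′ s≗s′ i rewrite π≗π′ i | π≗π′ (π′ i) | s≗s′ i = refl

statsᶜ-candidate : (π : Fin n → Fin n) (s : Fin n → Bool) → statsᶜ (candidate π s) ≡ statsOf π s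
statsᶜ-candidate {n} π s = ∑ˢ-cong (allFin n) (pointStats-cong (Vec.lookup∘tabulate π) (Vec.lookup∘tabulate s))

accept : (p q k : ℕ) → Stats → Bool
accept p q k (stats a b c d e) = (a ≡ᵇ 0) ∧ (b ≡ᵇ 0) ∧ ((c + q) ≡ᵇ (d + p)) ∧ (e ≡ᵇ 2 * k)

isSignedInvᵇ-as-accept : (k p q : ℕ) (c : Candidate (p + q)) → isSignedInvᵇ k p q c ≡ accept p q k (statsᶜ c)
isSignedInvᵇ-as-accept k p q c = cong (accept p q k) (stats-≡
  (countᵇ-as-∑ (λ i → not (π (π i) ==F i)) (allFin (p + q)))
  (countᵇ-as-∑ (λ i → not (π i ==F i) ∧ not (s i)) (allFin (p + q)))
  (countᵇ-as-∑ (λ i → (π i ==F i) ∧ s i) (allFin (p + q)))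
  (countᵇ-as-∑ (λ i → (π i ==F i) ∧ not (s i)) (allFin (p + q)))
  (countᵇ-as-∑ (λ i → not (π i ==F i)) (allFin (p + q))))
  where
  π = perm c
  s = sign c

signedCount : (n p q k : ℕ) → ℕ
signedCount n p q k = ∑[ c ∈ allCandidates n ] 𝟙 (accept p q k (statsᶜ c))

γ-as-signedCount : (k p q : ℕ) → γ k p q ≡ signedCount (p + q) p q k
γ-as-signedCount k p q = trans (countᵇ-as-∑ (isSignedInvᵇ k p q) (allCandidates (p + q)))
  (∑-cong (allCandidates (p + q)) (λ c → cong 𝟙 (isSignedInvᵇ-as-accept k p q c)))

-- The sign condition #+ + q = #- + p only depends on p - q.
accept-shift : (p q k : ℕ) (st : Stats) → accept (suc p) (suc q) k st ≡ accept p q k st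
accept-shift p q k (stats a b c d e) =
  cong (λ t → (a ≡ᵇ 0) ∧ (b ≡ᵇ 0) ∧ t ∧ (e ≡ᵇ 2 * k)) (cong₂ _≡ᵇ_ (+-suc c q) (+-suc d p))

signedCount-shift : (n p q k : ℕ) → signedCount n (suc p) (suc q) k ≡ signedCount n p q k
signedCount-shift n p q k = ∑-cong (allCandidates n) (λ c → cong 𝟙 (accept-shift p q k (statsᶜ c)))

-- At most n points carry a sign, so the sign condition fails when p and q are
-- more than n apart.
accept-unbalancedˡ : ∀ {p q} k (st : Stats) → plus st ≤ n → q + n < p → accept p q k st ≡ false
accept-unbalancedˡ {n} {p} {q} k (stats a b c d e) c≤n q+n<p =
  trans (cong (λ t → (a ≡ᵇ 0) ∧ (b ≡ᵇ 0) ∧ t ∧ (e ≡ᵇ 2 * k))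
              (≡ᵇ-false (c + q) (d + p) (λ eq → <-irrefl eq c+q<d+p)))
        (∧-false-third (a ≡ᵇ 0) (b ≡ᵇ 0) (e ≡ᵇ 2 * k))
  where
  c+q<d+p : c + q < d + p
  c+q<d+p = ≤-<-trans (≤-trans (+-monoˡ-≤ q c≤n) (≤-reflexive (+-comm n q))) (<-≤-trans q+n<p (m≤n+m p d))

accept-unbalancedʳ : ∀ {p q} k (st : Stats) → minus st ≤ n → p + n < q → accept p q k st ≡ false
accept-unbalancedʳ {n} {p} {q} k (stats a b c d e) d≤n p+n<q =
  trans (cong (λ t → (a ≡ᵇ 0) ∧ (b ≡ᵇ 0) ∧ t ∧ (e ≡ᵇ 2 * k))
              (≡ᵇ-false (c + q) (d + p) (λ eq → <-irrefl (sym eq) d+p<c+q)))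
        (∧-false-third (a ≡ᵇ 0) (b ≡ᵇ 0) (e ≡ᵇ 2 * k))
  where
  d+p<c+q : d + p < c + q
  d+p<c+q = ≤-<-trans (≤-trans (+-monoˡ-≤ p d≤n) (≤-reflexive (+-comm n p))) (<-≤-trans p+n<q (m≤n+m q c))

signedCount-vanishˡ : (n p q k : ℕ) → q + n < p → signedCount n p q k ≡ 0
signedCount-vanishˡ n p q k q+n<p = ∑-zero (allCandidates n) λ c →
  cong 𝟙 (accept-unbalancedˡ k (statsᶜ c) (∑-𝟙-allFin-≤ n _) q+n<p)

signedCount-vanishʳ : (n p q k : ℕ) → p + n < q → signedCount n p q k ≡ 0
signedCount-vanishʳ n p q k p+n<q = ∑-zero (allCandidates n) λ c →
  cong 𝟙 (accept-unbalancedʳ k (statsᶜ c) (∑-𝟙-allFin-≤ n _) p+n<q)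

accepted-clean : ∀ {p q k} (st : Stats) → accept p q k st ≡ true → nonInvolutive st ≡ 0 × unnormalised st ≡ 0
accepted-clean (stats a b c d e) acc with a ≡ᵇ 0 in a≡0 | b ≡ᵇ 0 in b≡0 | acc
... | true  | true  | _  = ≡ᵇ-sound a 0 a≡0 , ≡ᵇ-sound b 0 b≡0
... | true  | false | ()
... | false | _     | ()

accepted-involution : ∀ {p q k} (π : Fin n → Fin n) (s : Fin n → Bool) →
                      accept p q k (statsOf π s) ≡ true → ∀ i → π (π i) ≡ i
accepted-involution {n} {k = k} π s acc i = ==F-sound _ _ (not-false⇒
  (∑-𝟙-zero⇒false n (λ i → not (π (π i) ==F i)) (proj₁ (accepted-clean {k = k} (statsOf π s) acc)) i))

accepted-normalised : ∀ {p q k} (π : Fin n → Fin n) (s : Fin n → Bool) →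
                      accept p q k (statsOf π s) ≡ true → ∀ i → π i ≢ i → s i ≡ true
accepted-normalised {n} {k = k} π s acc i πi≢i = not-false⇒ (trans
  (cong (λ t → not t ∧ not (s i)) (sym (dec-false (π i ≟ i) πi≢i)))
  (∑-𝟙-zero⇒false n (λ i → not (π i ==F i) ∧ not (s i)) (proj₂ (accepted-clean {k = k} (statsOf π s) acc)) i))

headFixedWith : Bool → Candidate (suc n) → Bool
headFixedWith b c = (perm c zero ==F zero) ∧ does (sign c zero ≟ᴮ b)

headMoved : Candidate (suc n) → Bool
headMoved c = not (perm c zero ==F zero)

𝟙-split-head : ∀ P fixed s →
  𝟙 P ≡ 𝟙 (P ∧ (fixed ∧ does (s ≟ᴮ true))) + 𝟙 (P ∧ (fixed ∧ does (s ≟ᴮ false))) + 𝟙 (P ∧ not fixed)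
𝟙-split-head false fixed s     = refl
𝟙-split-head true  true  true  = refl
𝟙-split-head true  true  false = refl
𝟙-split-head true  false s     = refl

fixHead : (Fin n → Fin n) → Fin (suc n) → Fin (suc n)
fixHead π zero    = zero
fixHead π (suc i) = suc (π i)

signHead : Bool → (Fin n → Bool) → Fin (suc n) → Bool
signHead b s zero    = b
signHead b s (suc i) = s i

addFixedHead : Bool → Candidate n → Candidate (suc n)
addFixedHead b c = candidate (fixHead (perm c)) (signHead b (sign c))

-- The predecessor of a nonzero point (d is a dummy value for 0).
predOr : Fin n → Fin (suc n) → Fin n
predOr d zero    = d
predOr d (suc i) = i

predOr-suc : (d : Fin n) (a : Fin (suc n)) → a ≢ zero → a ≡ suc (predOr d a)
predOr-suc d zero    a≢0 = ⊥-elim (a≢0 refl)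
predOr-suc d (suc a) _   = refl

-- Removing the point 0 (meant for candidates fixing it).
dropHead : Candidate (suc n) → Candidate n
dropHead c = candidate (λ i → predOr i (perm c (suc i))) (sign c ∘ suc)

fixedPointStats : Bool → Stats
fixedPointStats true  = stats 0 0 1 0 0
fixedPointStats false = stats 0 0 0 1 0

statsᶜ-addFixedHead : (b : Bool) (c : Candidate n) → statsᶜ (addFixedHead b c) ≡ fixedPointStats b ⊕ statsᶜ c
statsᶜ-addFixedHead b c = trans (statsᶜ-candidate (fixHead (perm c)) (signHead b (sign c))) (split b)
  where
  split : ∀ b → statsOf (fixHead (perm c)) (signHead b (sign c)) ≡ fixedPointStats b ⊕ statsᶜ c
  split true  = ∑ˢ-allFin-suc (pointStats (fixHead (perm c)) (signHead true (sign c)))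
  split false = ∑ˢ-allFin-suc (pointStats (fixHead (perm c)) (signHead false (sign c)))

dropHead-addFixedHead : (b : Bool) (c : Candidate n) → dropHead (addFixedHead b c) ≡ c
dropHead-addFixedHead b c = trans
  (candidate-cong (λ i → cong (predOr i) (Vec.lookup∘tabulate (fixHead (perm c)) (suc i)))
                  (λ i → Vec.lookup∘tabulate (signHead b (sign c)) (suc i)))
  (candidate-η c)

-- In an accepted candidate fixing 0 no other point is mapped to 0, so removing
-- and re-adjoining the point 0 gives back the candidate.
addFixedHead-dropHead : ∀ {p q k} (c : Candidate (suc n)) → accept p q k (statsᶜ c) ≡ true →
                        perm c zero ≡ zero → addFixedHead (sign c zero) (dropHead c) ≡ c
addFixedHead-dropHead {k = k} c acc π0≡0 = trans (candidate-cong perm≗ sign≗) (candidate-η c)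
  where
  π = perm c
  perm≗ : ∀ i → fixHead (perm (dropHead c)) i ≡ π i
  perm≗ zero    = sym π0≡0
  perm≗ (suc i) with π (suc i) in πi | Vec.lookup∘tabulate (λ i → predOr i (π (suc i))) i
  ... | zero  | _ = ⊥-elim (0≢1+n (begin
                      zero             ≡⟨ sym π0≡0 ⟩
                      π zero           ≡⟨ cong π (sym πi) ⟩
                      π (π (suc i))    ≡⟨ accepted-involution {k = k} π (sign c) acc (suc i) ⟩
                      suc i            ∎))
  ... | suc j | e = cong suc e
  sign≗ : ∀ i → signHead (sign c zero) (sign (dropHead c)) i ≡ sign c i
  sign≗ zero    = refl
  sign≗ (suc i) = Vec.lookup∘tabulate (sign c ∘ suc) i

headFixed-count : (b : Bool) (n p q k : ℕ) →
  ∑[ c ∈ allCandidates (suc n) ] 𝟙 (accept p q k (statsᶜ c) ∧ headFixedWith b c)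
    ≡ ∑[ c ∈ allCandidates n ] 𝟙 (accept p q k (fixedPointStats b ⊕ statsᶜ c))
headFixed-count b n p q k = count-bijection (candidates-enumerate (suc n)) (candidates-enumerate n)
  (λ c → accept p q k (statsᶜ c) ∧ headFixedWith b c) (λ c → accept p q k (fixedPointStats b ⊕ statsᶜ c))
  dropHead (addFixedHead b) accepted-addFixedHead (dropHead-addFixedHead b) addFixedHead-dropHead′
  where
  accepted-addFixedHead : ∀ c → (accept p q k (statsᶜ (addFixedHead b c)) ∧ (true ∧ does (b ≟ᴮ b)))
                                 ≡ accept p q k (fixedPointStats b ⊕ statsᶜ c)
  accepted-addFixedHead c = begin
    accept p q k (statsᶜ (addFixedHead b c)) ∧ (true ∧ does (b ≟ᴮ b))
      ≡⟨ cong (λ t → accept p q k (statsᶜ (addFixedHead b c)) ∧ t) (dec-true (b ≟ᴮ b) refl) ⟩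
    accept p q k (statsᶜ (addFixedHead b c)) ∧ true
      ≡⟨ ∧-identityʳ _ ⟩
    accept p q k (statsᶜ (addFixedHead b c))
      ≡⟨ cong (accept p q k) (statsᶜ-addFixedHead b c) ⟩
    accept p q k (fixedPointStats b ⊕ statsᶜ c) ∎

  addFixedHead-dropHead′ : ∀ c → (accept p q k (statsᶜ c) ∧ headFixedWith b c) ≡ true → addFixedHead b (dropHead c) ≡ c
  addFixedHead-dropHead′ c acc∧fixed =
    subst (λ b → addFixedHead b (dropHead c) ≡ c) s0≡b (addFixedHead-dropHead {p = p} {q} {k} c acc π0≡0)
    where
    acc   = ∧-true-left (accept p q k (statsᶜ c)) acc∧fixed
    fixed = ∧-true-right (accept p q k (statsᶜ c)) acc∧fixed
    π0≡0 : perm c zero ≡ zero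
    π0≡0 = ==F-sound _ _ (∧-true-left (perm c zero ==F zero) fixed)
    s0≡b : sign c zero ≡ b
    s0≡b = does-true⇒ (sign c zero ≟ᴮ b) (∧-true-right (perm c zero ==F zero) fixed)

data PunchView {n : ℕ} (j : Fin (suc n)) : Fin (suc n) → Set where
  at      : PunchView j j
  punched : (i : Fin n) → PunchView j (punchIn j i)

punchView : (j x : Fin (suc n)) → PunchView j x
punchView         zero    zero    = at
punchView         zero    (suc x) = punched x
punchView {suc n} (suc j) zero    = punched zero
punchView {suc n} (suc j) (suc x) with punchView j x
... | at        = at
... | punched i = punched (suc i)

punchView-at : (j : Fin (suc n)) → punchView j j ≡ at
punchView-at         zero    = refl
punchView-at {suc n} (suc j) rewrite punchView-at j = refl

punchView-punched : (j : Fin (suc n)) (i : Fin n) → punchView j (punchIn j i) ≡ punched i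
punchView-punched         zero    i       = refl
punchView-punched {suc n} (suc j) zero    = refl
punchView-punched {suc n} (suc j) (suc i) rewrite punchView-punched j i = refl

-- The inverse of punchIn j (d is a dummy value for j).
punchOutOr : Fin n → (j x : Fin (suc n)) → Fin n
punchOutOr d j x = fromView (punchView j x)
  where
  fromView : ∀ {x} → PunchView j x → Fin _
  fromView at          = d
  fromView (punched i) = i

punchOutOr-punchIn : (d : Fin n) (j : Fin (suc n)) (i : Fin n) → punchOutOr d j (punchIn j i) ≡ i
punchOutOr-punchIn d j i rewrite punchView-punched j i = refl

-- Adjoining the 2-cycle (0 , suc j), with sign + on both points; the old point i
-- becomes suc (punchIn j i).
pairHead : Fin (suc n) → (Fin n → Fin n) → Fin (suc (suc n)) → Fin (suc (suc n))
pairHead j π zero    = suc j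
pairHead j π (suc x) = fromView (punchView j x)
  where
  fromView : ∀ {x} → PunchView j x → Fin _
  fromView at          = zero
  fromView (punched i) = suc (punchIn j (π i))

pairSigns : Fin (suc n) → (Fin n → Bool) → Fin (suc (suc n)) → Bool
pairSigns j s zero    = true
pairSigns j s (suc x) = fromView (punchView j x)
  where
  fromView : ∀ {x} → PunchView j x → Bool
  fromView at          = true
  fromView (punched i) = s i

pairHead-at : (j : Fin (suc n)) (π : Fin n → Fin n) → pairHead j π (suc j) ≡ zero
pairHead-at j π rewrite punchView-at j = refl

pairHead-punched : (j : Fin (suc n)) (π : Fin n → Fin n) (i : Fin n) →
                   pairHead j π (suc (punchIn j i)) ≡ suc (punchIn j (π i))
pairHead-punched j π i rewrite punchView-punched j i = refl

pairSigns-at : (j : Fin (suc n)) (s : Fin n → Bool) → pairSigns j s (suc j) ≡ true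
pairSigns-at j s rewrite punchView-at j = refl

pairSigns-punched : (j : Fin (suc n)) (s : Fin n → Bool) (i : Fin n) → pairSigns j s (suc (punchIn j i)) ≡ s i
pairSigns-punched j s i rewrite punchView-punched j i = refl

addPair : Fin (suc n) × Candidate n → Candidate (suc (suc n))
addPair (j , c) = candidate (pairHead j (perm c)) (pairSigns j (sign c))

-- Removing the 2-cycle through 0 (meant for candidates moving 0).
unpair : Candidate (suc (suc n)) → Fin (suc n) × Candidate n
unpair c = j , candidate (λ i → punchOutOr i j (predOr j (perm c (suc (punchIn j i)))))
                         (λ i → sign c (suc (punchIn j i)))
  where j = predOr zero (perm c zero)

twoCycleStats : Stats
twoCycleStats = stats 0 0 0 0 2

statsᶜ-addPair : (j : Fin (suc n)) (c : Candidate n) → statsᶜ (addPair (j , c)) ≡ twoCycleStats ⊕ statsᶜ c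
statsᶜ-addPair {n} j c = begin
  statsᶜ (addPair (j , c))
    ≡⟨ statsᶜ-candidate π′ s′ ⟩
  statsOf π′ s′
    ≡⟨ ∑ˢ-allFin-suc (pointStats π′ s′) ⟩
  pointStats π′ s′ zero ⊕ ∑ˢ (allFin (suc n)) (pointStats π′ s′ ∘ suc)
    ≡⟨ cong₂ _⊕_ (pointStats-at {π = π′} {s′} {zero} refl (pairHead-at j π) refl)
                 (∑ˢ-allFin-punchIn j (pointStats π′ s′ ∘ suc)) ⟩
  stats 0 0 0 0 1 ⊕ (pointStats π′ s′ (suc j) ⊕ ∑ˢ (allFin n) (pointStats π′ s′ ∘ suc ∘ punchIn j))
    ≡⟨ cong (stats 0 0 0 0 1 ⊕_) (cong₂ _⊕_ partner (∑ˢ-cong (allFin n) others)) ⟩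
  stats 0 0 0 0 1 ⊕ (stats 0 0 0 0 1 ⊕ statsᶜ c) ∎
  where
  π  = perm c
  π′ = pairHead j π
  s′ = pairSigns j (sign c)
  partner : pointStats π′ s′ (suc j) ≡ stats 0 0 0 0 1
  partner = trans (pointStats-at {π = π′} {s′} {suc j} (pairHead-at j π) refl (pairSigns-at j (sign c)))
                  (cong (λ u → stats (𝟙 (not u)) 0 0 0 1) (==F-refl (suc j)))
  others : ∀ i → pointStats π′ s′ (suc (punchIn j i)) ≡ pointStats π (sign c) i
  others i = trans (pointStats-at {π = π′} {s′} {suc (punchIn j i)}
                     (pairHead-punched j π i) (pairHead-punched j π (π i)) (pairSigns-punched j (sign c) i))
                   (localStats-punchIn j i (π i) (π (π i)) (sign c i))

unpair-addPair : (jc : Fin (suc n) × Candidate n) → unpair (addPair jc) ≡ jc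
unpair-addPair (j , c) = cong (j ,_) (trans (candidate-cong perm≗ sign≗) (candidate-η c))
  where
  perm≗ : ∀ i → punchOutOr i j (predOr j (perm (addPair (j , c)) (suc (punchIn j i)))) ≡ perm c i
  perm≗ i = begin
    punchOutOr i j (predOr j (perm (addPair (j , c)) (suc (punchIn j i))))
      ≡⟨ cong (punchOutOr i j ∘ predOr j) (Vec.lookup∘tabulate (pairHead j (perm c)) (suc (punchIn j i))) ⟩
    punchOutOr i j (predOr j (pairHead j (perm c) (suc (punchIn j i))))
      ≡⟨ cong (punchOutOr i j ∘ predOr j) (pairHead-punched j (perm c) i) ⟩
    punchOutOr i j (punchIn j (perm c i))
      ≡⟨ punchOutOr-punchIn i j (perm c i) ⟩
    perm c i ∎
  sign≗ : ∀ i → sign (addPair (j , c)) (suc (punchIn j i)) ≡ sign c i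
  sign≗ i = trans (Vec.lookup∘tabulate (pairSigns j (sign c)) (suc (punchIn j i))) (pairSigns-punched j (sign c) i)

-- In an involution π with π 0 = suc j the other points are permuted among
-- themselves: π (suc (punchIn j i)) is again of the form suc (punchIn j i′).
involution-rest : (π : Fin (suc (suc n)) → Fin (suc (suc n))) → (∀ x → π (π x) ≡ x) →
                  (j : Fin (suc n)) → π zero ≡ suc j → (i : Fin n) →
                  suc (punchIn j (punchOutOr i j (predOr j (π (suc (punchIn j i)))))) ≡ π (suc (punchIn j i))
involution-rest π inv j π0≡j i with π (suc (punchIn j i)) in πx
... | zero  = ⊥-elim (punchInᵢ≢i j i (Fin-suc-injective (begin
                suc (punchIn j i)          ≡⟨ sym (inv _) ⟩
                π (π (suc (punchIn j i)))  ≡⟨ cong π πx ⟩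
                π zero                     ≡⟨ π0≡j ⟩
                suc j                      ∎)))
... | suc w with punchView j w
...   | at         = ⊥-elim (0≢1+n (begin
                       zero                       ≡⟨ sym (inv zero) ⟩
                       π (π zero)                 ≡⟨ cong π π0≡j ⟩
                       π (suc j)                  ≡⟨ cong π (sym πx) ⟩
                       π (π (suc (punchIn j i)))  ≡⟨ inv _ ⟩
                       suc (punchIn j i)          ∎))
...   | punched i′ = refl

addPair-unpair : ∀ {p q k} (c : Candidate (suc (suc n))) → accept p q k (statsᶜ c) ≡ true →
                 perm c zero ≢ zero → addPair (unpair c) ≡ c
addPair-unpair {k = k} c acc π0≢0 = trans (candidate-cong perm≗ sign≗) (candidate-η c)
  where
  π = perm c
  s = sign c
  j = predOr zero (π zero)
  c′ = proj₂ (unpair c)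
  inv : ∀ x → π (π x) ≡ x
  inv = accepted-involution {k = k} π s acc
  π0≡j : π zero ≡ suc j
  π0≡j = predOr-suc zero (π zero) π0≢0
  πj≡0 : π (suc j) ≡ zero
  πj≡0 = trans (cong π (sym π0≡j)) (inv zero)
  perm≗ : ∀ x → pairHead j (perm c′) x ≡ π x
  perm≗ zero    = sym π0≡j
  perm≗ (suc x) with punchView j x
  ... | at        = sym πj≡0
  ... | punched i = trans (cong (suc ∘ punchIn j) (Vec.lookup∘tabulate _ i)) (involution-rest π inv j π0≡j i)
  sign≗ : ∀ x → pairSigns j (sign c′) x ≡ s x
  sign≗ zero    = sym (accepted-normalised {k = k} π s acc zero π0≢0)
  sign≗ (suc x) with punchView j x
  ... | at        = sym (accepted-normalised {k = k} π s acc (suc j) (λ e → 0≢1+n (trans (sym πj≡0) e)))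
  ... | punched i = Vec.lookup∘tabulate (λ i → s (suc (punchIn j i))) i

headMoved-as-pairs : (n p q k : ℕ) →
  ∑[ c ∈ allCandidates (suc (suc n)) ] 𝟙 (accept p q k (statsᶜ c) ∧ headMoved c)
    ≡ ∑[ jc ∈ cartesianProduct (allFin (suc n)) (allCandidates n) ] 𝟙 (accept p q k (twoCycleStats ⊕ statsᶜ (proj₂ jc)))
headMoved-as-pairs n p q k = count-bijection (candidates-enumerate (suc (suc n)))
  (cartesianProduct-enumerates (allFin-enumerates (suc n)) (candidates-enumerate n))
  (λ c → accept p q k (statsᶜ c) ∧ headMoved c) (λ jc → accept p q k (twoCycleStats ⊕ statsᶜ (proj₂ jc)))
  unpair addPair accepted-addPair unpair-addPair addPair-unpair′
  where
  accepted-addPair : ∀ jc → (accept p q k (statsᶜ (addPair jc)) ∧ true)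
                             ≡ accept p q k (twoCycleStats ⊕ statsᶜ (proj₂ jc))
  accepted-addPair (j , c) = trans (∧-identityʳ _) (cong (accept p q k) (statsᶜ-addPair j c))

  addPair-unpair′ : ∀ c → (accept p q k (statsᶜ c) ∧ headMoved c) ≡ true → addPair (unpair c) ≡ c
  addPair-unpair′ c acc∧moved = addPair-unpair {p = p} {q} {k} c (∧-true-left (accept p q k (statsᶜ c)) acc∧moved)
    (does-false⇒ (perm c zero ≟ zero) (not-true⇒ (∧-true-right (accept p q k (statsᶜ c)) acc∧moved)))

accept-fixedPlus : (p q k : ℕ) (st : Stats) → accept p q k (fixedPointStats true ⊕ st) ≡ accept p (suc q) k st
accept-fixedPlus p q k (stats a b c d e) =
  cong (λ t → (a ≡ᵇ 0) ∧ (b ≡ᵇ 0) ∧ (t ≡ᵇ d + p) ∧ (e ≡ᵇ 2 * k)) (sym (+-suc c q))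

accept-fixedMinus : (p q k : ℕ) (st : Stats) → accept p q k (fixedPointStats false ⊕ st) ≡ accept (suc p) q k st
accept-fixedMinus p q k (stats a b c d e) =
  cong (λ t → (a ≡ᵇ 0) ∧ (b ≡ᵇ 0) ∧ (c + q ≡ᵇ t) ∧ (e ≡ᵇ 2 * k)) (sym (+-suc d p))

accept-twoCycle : (p q k : ℕ) (st : Stats) → accept p q (suc k) (twoCycleStats ⊕ st) ≡ accept p q k st
accept-twoCycle p q k (stats a b c d e) =
  cong (λ t → (a ≡ᵇ 0) ∧ (b ≡ᵇ 0) ∧ (c + q ≡ᵇ d + p) ∧ (suc (suc e) ≡ᵇ t)) (*-suc 2 k)

accept-twoCycle-zero : (p q : ℕ) (st : Stats) → accept p q 0 (twoCycleStats ⊕ st) ≡ false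
accept-twoCycle-zero p q (stats a b c d e) = ∧-false-last (a ≡ᵇ 0) (b ≡ᵇ 0) (c + q ≡ᵇ d + p)

-- The number of accepted candidates on suc n points in which 0 is moved.
headPairedCount : (n p q k : ℕ) → ℕ
headPairedCount zero    p q k       = 0
headPairedCount (suc n) p q zero    = 0
headPairedCount (suc n) p q (suc k) = suc n * signedCount n p q k

headPaired-count : (n p q k : ℕ) →
  ∑[ c ∈ allCandidates (suc n) ] 𝟙 (accept p q k (statsᶜ c) ∧ headMoved c) ≡ headPairedCount n p q k
headPaired-count zero p q k = ∑-zero (allCandidates 1) head-fixed
  where
  head-fixed : ∀ c → 𝟙 (accept p q k (statsᶜ c) ∧ headMoved c) ≡ 0
  head-fixed c with perm c zero
  ... | zero = cong 𝟙 (∧-zeroʳ _)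
  ... | suc ()
headPaired-count (suc n) p q zero = trans (headMoved-as-pairs n p q 0)
  (∑-zero (cartesianProduct (allFin (suc n)) (allCandidates n))
          (λ jc → cong 𝟙 (accept-twoCycle-zero p q (statsᶜ (proj₂ jc)))))
headPaired-count (suc n) p q (suc k) = begin
  ∑[ c ∈ allCandidates (suc (suc n)) ] 𝟙 (accept p q (suc k) (statsᶜ c) ∧ headMoved c)
    ≡⟨ headMoved-as-pairs n p q (suc k) ⟩
  ∑[ jc ∈ cartesianProduct (allFin (suc n)) (allCandidates n) ] 𝟙 (accept p q (suc k) (twoCycleStats ⊕ statsᶜ (proj₂ jc)))
    ≡⟨ ∑-cartesianProduct (allFin (suc n)) (allCandidates n) _ ⟩
  ∑[ j ∈ allFin (suc n) ] ∑[ c ∈ allCandidates n ] 𝟙 (accept p q (suc k) (twoCycleStats ⊕ statsᶜ c))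
    ≡⟨ ∑-cong (allFin (suc n)) (λ _ →
         ∑-cong (allCandidates n) (λ c → cong 𝟙 (accept-twoCycle p q k (statsᶜ c)))) ⟩
  ∑[ j ∈ allFin (suc n) ] signedCount n p q k
    ≡⟨ ∑-allFin-const (suc n) (signedCount n p q k) ⟩
  suc n * signedCount n p q k ∎

-- Classifying the candidates by the behaviour of the point 0.
signedCount-step : (n p q k : ℕ) →
  signedCount (suc n) p q k ≡ signedCount n p (suc q) k + signedCount n (suc p) q k + headPairedCount n p q k
signedCount-step n p q k = begin
  ∑[ c ∈ cs ] 𝟙 (acc c)
    ≡⟨ ∑-cong cs (λ c → 𝟙-split-head (acc c) (perm c zero ==F zero) (sign c zero)) ⟩
  ∑[ c ∈ cs ] (𝟙 (acc c ∧ headFixedWith true c) + 𝟙 (acc c ∧ headFixedWith false c) + 𝟙 (acc c ∧ headMoved c))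
    ≡⟨ trans (∑-+ cs _ _) (cong (_+ ∑[ c ∈ cs ] 𝟙 (acc c ∧ headMoved c)) (∑-+ cs _ _)) ⟩
  ∑[ c ∈ cs ] 𝟙 (acc c ∧ headFixedWith true c) + ∑[ c ∈ cs ] 𝟙 (acc c ∧ headFixedWith false c)
    + ∑[ c ∈ cs ] 𝟙 (acc c ∧ headMoved c)
    ≡⟨ cong₂ _+_ (cong₂ _+_ (fixed true (accept-fixedPlus p q k)) (fixed false (accept-fixedMinus p q k)))
                 (headPaired-count n p q k) ⟩
  signedCount n p (suc q) k + signedCount n (suc p) q k + headPairedCount n p q k ∎
  where
  cs = allCandidates (suc n)
  acc : Candidate (suc n) → Bool
  acc c = accept p q k (statsᶜ c)
  fixed : ∀ b {p′ q′} → (∀ st → accept p q k (fixedPointStats b ⊕ st) ≡ accept p′ q′ k st) →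
          ∑[ c ∈ cs ] 𝟙 (acc c ∧ headFixedWith b c) ≡ signedCount n p′ q′ k
  fixed b shift = trans (headFixed-count b n p q k) (∑-cong (allCandidates n) (λ c → cong 𝟙 (shift (statsᶜ c))))

headPairedCount-vanishˡ : (n p q k : ℕ) → q + n < suc p → headPairedCount n p q k ≡ 0
headPairedCount-vanishˡ zero    p q k       _  = refl
headPairedCount-vanishˡ (suc n) p q zero    _  = refl
headPairedCount-vanishˡ (suc n) p q (suc k) lt =
  trans (cong (suc n *_) (signedCount-vanishˡ n p q k (≤-pred (subst (_< suc p) (+-suc q n) lt)))) (*-zeroʳ (suc n))

headPairedCount-vanishʳ : (n p q k : ℕ) → p + n < suc q → headPairedCount n p q k ≡ 0
headPairedCount-vanishʳ zero    p q k       _  = refl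
headPairedCount-vanishʳ (suc n) p q zero    _  = refl
headPairedCount-vanishʳ (suc n) p q (suc k) lt =
  trans (cong (suc n *_) (signedCount-vanishʳ n p q k (≤-pred (subst (_< suc q) (+-suc p n) lt)))) (*-zeroʳ (suc n))

involutionCount : ℕ → ℕ → ℕ → ℕ
involutionCount p q k = signedCount (p + q) p q k

involutionCount-solves : SolvesRecurrence involutionCount
involutionCount-solves = record { initial = initial′ ; step = step′ }
  where
  initial′ : ∀ k → involutionCount 0 0 k ≡ 𝟙 (0 ≡ᵇ k)
  initial′ zero    = refl
  initial′ (suc k) = refl

  step′ : ∀ p q k → 0 < p + q → involutionCount p q k ≡ lastStep involutionCount p q k
  step′ (suc p) zero k _ = begin
    signedCount (suc (p + 0)) (suc p) 0 k
      ≡⟨ signedCount-step (p + 0) (suc p) 0 k ⟩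
    signedCount (p + 0) (suc p) 1 k + signedCount (p + 0) (suc (suc p)) 0 k + headPairedCount (p + 0) (suc p) 0 k
      ≡⟨ cong₂ _+_ (cong₂ _+_ (signedCount-shift (p + 0) p 0 k) (signedCount-vanishˡ (p + 0) (suc (suc p)) 0 k p+0<2+p))
                   (headPairedCount-vanishˡ (p + 0) (suc p) 0 k p+0<2+p) ⟩
    signedCount (p + 0) p 0 k + 0 + 0 ∎
    where
    p+0<2+p : p + 0 < suc (suc p)
    p+0<2+p = s≤s (≤-trans (≤-reflexive (+-identityʳ p)) (n≤1+n p))
  step′ zero (suc q) k _ = begin
    signedCount (suc q) 0 (suc q) k
      ≡⟨ signedCount-step q 0 (suc q) k ⟩
    signedCount q 0 (suc (suc q)) k + signedCount q 1 (suc q) k + headPairedCount q 0 (suc q) k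
      ≡⟨ cong₂ _+_ (cong₂ _+_ (signedCount-vanishʳ q 0 (suc (suc q)) k q<2+q) (signedCount-shift q 0 q k))
                   (headPairedCount-vanishʳ q 0 (suc q) k q<2+q) ⟩
    0 + signedCount q 0 q k + 0 ∎
    where
    q<2+q : q < suc (suc q)
    q<2+q = s≤s (n≤1+n q)
  step′ (suc p) (suc q) k _ = begin
    signedCount (suc (p + suc q)) (suc p) (suc q) k
      ≡⟨ signedCount-step (p + suc q) (suc p) (suc q) k ⟩
    signedCount (p + suc q) (suc p) (suc (suc q)) k + signedCount (p + suc q) (suc (suc p)) (suc q) k
      + headPairedCount (p + suc q) (suc p) (suc q) k
      ≡⟨ cong₂ _+_ (cong₂ _+_ (signedCount-shift (p + suc q) p (suc q) k)
                              (trans (signedCount-shift (p + suc q) (suc p) q k)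
                                     (cong (λ n → signedCount n (suc p) q k) (+-suc p q))))
                   (trans (cong (λ n → headPairedCount n (suc p) (suc q) k) (+-suc p q)) (paired k)) ⟩
    lastStep involutionCount (suc p) (suc q) k ∎
    where
    -- A 2-cycle through 0 leaves p + q points, with the same balance.
    paired : ∀ k → headPairedCount (suc (p + q)) (suc p) (suc q) k ≡ fromDiag involutionCount (suc p) (suc q) k
    paired zero    = refl
    paired (suc k) = cong (suc (p + q) *_) (signedCount-shift (p + q) p q k)

-- Weighted Delannoy paths.  validFrom with the final test made a parameter, so
-- that the last step of a path can be moved into it.
validWith : (ℕ → ℕ → Bool) → ℕ → ℕ → List WStep → Bool
validWith E a b []           = E a b
validWith E a b (east ∷ w)   = validWith E (suc a) b w
validWith E a b (north ∷ w)  = validWith E a (suc b) w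
validWith E a b (diag m ∷ w) = (1 ≤ᵇ m) ∧ (m ≤ᵇ suc (a + b)) ∧ validWith E (suc a) (suc b) w

endsAt : ℕ → ℕ → ℕ → ℕ → Bool
endsAt p q a b = (a ≡ᵇ p) ∧ (b ≡ᵇ q)

validFrom-as-validWith : ∀ p q a b w → validFrom p q a b w ≡ validWith (endsAt p q) a b w
validFrom-as-validWith p q a b []           = refl
validFrom-as-validWith p q a b (east ∷ w)   = validFrom-as-validWith p q (suc a) b w
validFrom-as-validWith p q a b (north ∷ w)  = validFrom-as-validWith p q a (suc b) w
validFrom-as-validWith p q a b (diag m ∷ w) =
  cong (λ t → (1 ≤ᵇ m) ∧ (m ≤ᵇ suc (a + b)) ∧ t) (validFrom-as-validWith p q (suc a) (suc b) w)

validWith-snoc : ∀ E a b w x →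
                 validWith E a b (w ++ x ∷ []) ≡ validWith (λ a′ b′ → validWith E a′ b′ (x ∷ [])) a b w
validWith-snoc E a b []           x = refl
validWith-snoc E a b (east ∷ w)   x = validWith-snoc E (suc a) b w x
validWith-snoc E a b (north ∷ w)  x = validWith-snoc E a (suc b) w x
validWith-snoc E a b (diag m ∷ w) x =
  cong (λ t → (1 ≤ᵇ m) ∧ (m ≤ᵇ suc (a + b)) ∧ t) (validWith-snoc E (suc a) (suc b) w x)

validWith-cong : ∀ {E E′} → (∀ a b → E a b ≡ E′ a b) → ∀ a b w → validWith E a b w ≡ validWith E′ a b w
validWith-cong E≗E′ a b []           = E≗E′ a b
validWith-cong E≗E′ a b (east ∷ w)   = validWith-cong E≗E′ (suc a) b w
validWith-cong E≗E′ a b (north ∷ w)  = validWith-cong E≗E′ a (suc b) w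
validWith-cong E≗E′ a b (diag m ∷ w) =
  cong (λ t → (1 ≤ᵇ m) ∧ (m ≤ᵇ suc (a + b)) ∧ t) (validWith-cong E≗E′ (suc a) (suc b) w)

validWith-false : ∀ a b w → validWith (λ _ _ → false) a b w ≡ false
validWith-false a b []           = refl
validWith-false a b (east ∷ w)   = validWith-false (suc a) b w
validWith-false a b (north ∷ w)  = validWith-false a (suc b) w
validWith-false a b (diag m ∷ w) rewrite validWith-false (suc a) (suc b) w =
  trans (cong ((1 ≤ᵇ m) ∧_) (∧-zeroʳ (m ≤ᵇ suc (a + b)))) (∧-zeroʳ (1 ≤ᵇ m))

validWith-∧ : ∀ E c a b w → validWith (λ a′ b′ → E a′ b′ ∧ c) a b w ≡ validWith E a b w ∧ c
validWith-∧ E c a b []           = refl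
validWith-∧ E c a b (east ∷ w)   = validWith-∧ E c (suc a) b w
validWith-∧ E c a b (north ∷ w)  = validWith-∧ E c a (suc b) w
validWith-∧ E c a b (diag m ∷ w) rewrite validWith-∧ E c (suc a) (suc b) w =
  trans (cong ((1 ≤ᵇ m) ∧_) (sym (∧-assoc (m ≤ᵇ suc (a + b)) _ c))) (sym (∧-assoc (1 ≤ᵇ m) _ c))

numDiag-snoc : ∀ w x → numDiag (w ++ x ∷ []) ≡ numDiag (x ∷ []) + numDiag w
numDiag-snoc []           x = sym (+-identityʳ (numDiag (x ∷ [])))
numDiag-snoc (east ∷ w)   x = numDiag-snoc w x
numDiag-snoc (north ∷ w)  x = numDiag-snoc w x
numDiag-snoc (diag _ ∷ w) x = trans (cong suc (numDiag-snoc w x)) (sym (+-suc (numDiag (x ∷ [])) (numDiag w)))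

isPath : ℕ → ℕ → ℕ → List WStep → Bool
isPath p q k w = validFrom p q 0 0 w ∧ (numDiag w ≡ᵇ k)

-- The admissible labels 1 … t+1 of a diagonal step leaving a point with a + b = t.
labelOk : ℕ → ℕ → Bool
labelOk t m = (1 ≤ᵇ m) ∧ (m ≤ᵇ suc t)

private
  validFrom-snoc : ∀ p q w x → validFrom p q 0 0 (w ++ x ∷ []) ≡
                   validWith (λ a b → validWith (endsAt p q) a b (x ∷ [])) 0 0 w
  validFrom-snoc p q w x = trans (validFrom-as-validWith p q 0 0 (w ++ x ∷ [])) (validWith-snoc (endsAt p q) 0 0 w x)

  label-at-end : ∀ p q m a b → ((1 ≤ᵇ m) ∧ (m ≤ᵇ suc (a + b)) ∧ endsAt p q a b) ≡ (endsAt p q a b ∧ labelOk (p + q) m)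
  label-at-end p q m a b with a ≡ᵇ p in a≡p | b ≡ᵇ q in b≡q
  ... | true  | true  rewrite ≡ᵇ-sound a p a≡p | ≡ᵇ-sound b q b≡q = cong ((1 ≤ᵇ m) ∧_) (∧-identityʳ _)
  ... | true  | false = ∧-false-last (1 ≤ᵇ m) (m ≤ᵇ suc (a + b)) true
  ... | false | _     = trans (cong (λ t → (1 ≤ᵇ m) ∧ t) (∧-zeroʳ (m ≤ᵇ suc (a + b)))) (∧-zeroʳ (1 ≤ᵇ m))

isPath-east : ∀ p q k w → isPath (suc p) q k (w ++ east ∷ []) ≡ isPath p q k w
isPath-east p q k w = cong₂ _∧_ (trans (validFrom-snoc (suc p) q w east) (sym (validFrom-as-validWith p q 0 0 w)))
                                (cong (_≡ᵇ k) (numDiag-snoc w east))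

isPath-east-0 : ∀ q k w → isPath 0 q k (w ++ east ∷ []) ≡ false
isPath-east-0 q k w = cong (_∧ (numDiag (w ++ east ∷ []) ≡ᵇ k)) (trans (validFrom-snoc 0 q w east) (validWith-false 0 0 w))

isPath-north : ∀ p q k w → isPath p (suc q) k (w ++ north ∷ []) ≡ isPath p q k w
isPath-north p q k w = cong₂ _∧_ (trans (validFrom-snoc p (suc q) w north) (sym (validFrom-as-validWith p q 0 0 w)))
                                 (cong (_≡ᵇ k) (numDiag-snoc w north))

isPath-north-0 : ∀ p k w → isPath p 0 k (w ++ north ∷ []) ≡ false
isPath-north-0 p k w = cong (_∧ (numDiag (w ++ north ∷ []) ≡ᵇ k)) (begin
  validFrom p 0 0 0 (w ++ north ∷ [])
    ≡⟨ validFrom-snoc p 0 w north ⟩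
  validWith (λ a b → (a ≡ᵇ p) ∧ false) 0 0 w
    ≡⟨ validWith-cong (λ a b → ∧-zeroʳ (a ≡ᵇ p)) 0 0 w ⟩
  validWith (λ _ _ → false) 0 0 w
    ≡⟨ validWith-false 0 0 w ⟩
  false ∎)

isPath-diag : ∀ p q k m w → isPath (suc p) (suc q) (suc k) (w ++ diag m ∷ []) ≡ labelOk (p + q) m ∧ isPath p q k w
isPath-diag p q k m w = begin
  validFrom (suc p) (suc q) 0 0 (w ++ diag m ∷ []) ∧ (numDiag (w ++ diag m ∷ []) ≡ᵇ suc k)
    ≡⟨ cong₂ _∧_ valid (cong (_≡ᵇ suc k) (numDiag-snoc w (diag m))) ⟩
  (validFrom p q 0 0 w ∧ labelOk (p + q) m) ∧ (numDiag w ≡ᵇ k)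
    ≡⟨ ∧-assoc (validFrom p q 0 0 w) _ _ ⟩
  validFrom p q 0 0 w ∧ (labelOk (p + q) m ∧ (numDiag w ≡ᵇ k))
    ≡⟨ cong (validFrom p q 0 0 w ∧_) (∧-comm (labelOk (p + q) m) _) ⟩
  validFrom p q 0 0 w ∧ ((numDiag w ≡ᵇ k) ∧ labelOk (p + q) m)
    ≡⟨ sym (∧-assoc (validFrom p q 0 0 w) _ _) ⟩
  isPath p q k w ∧ labelOk (p + q) m
    ≡⟨ ∧-comm (isPath p q k w) _ ⟩
  labelOk (p + q) m ∧ isPath p q k w ∎
  where
  valid : validFrom (suc p) (suc q) 0 0 (w ++ diag m ∷ []) ≡ validFrom p q 0 0 w ∧ labelOk (p + q) m
  valid = begin
    validFrom (suc p) (suc q) 0 0 (w ++ diag m ∷ [])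
      ≡⟨ validFrom-snoc (suc p) (suc q) w (diag m) ⟩
    validWith (λ a b → (1 ≤ᵇ m) ∧ (m ≤ᵇ suc (a + b)) ∧ endsAt p q a b) 0 0 w
      ≡⟨ validWith-cong (label-at-end p q m) 0 0 w ⟩
    validWith (λ a b → endsAt p q a b ∧ labelOk (p + q) m) 0 0 w
      ≡⟨ validWith-∧ (endsAt p q) (labelOk (p + q) m) 0 0 w ⟩
    validWith (endsAt p q) 0 0 w ∧ labelOk (p + q) m
      ≡⟨ cong (_∧ labelOk (p + q) m) (sym (validFrom-as-validWith p q 0 0 w)) ⟩
    validFrom p q 0 0 w ∧ labelOk (p + q) m ∎

isPath-diag-p0 : ∀ q k m w → isPath 0 q k (w ++ diag m ∷ []) ≡ false
isPath-diag-p0 q k m w = cong (_∧ (numDiag (w ++ diag m ∷ []) ≡ᵇ k)) (trans (validFrom-snoc 0 q w (diag m))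
  (trans (validWith-cong (λ a b → ∧-false-last (1 ≤ᵇ m) (m ≤ᵇ suc (a + b)) true) 0 0 w) (validWith-false 0 0 w)))

isPath-diag-q0 : ∀ p k m w → isPath (suc p) 0 k (w ++ diag m ∷ []) ≡ false
isPath-diag-q0 p k m w = cong (_∧ (numDiag (w ++ diag m ∷ []) ≡ᵇ k)) (trans (validFrom-snoc (suc p) 0 w (diag m))
  (trans (validWith-cong (λ a b → ∧-false-last (1 ≤ᵇ m) (m ≤ᵇ suc (a + b)) (a ≡ᵇ p)) 0 0 w) (validWith-false 0 0 w)))

isPath-diag-k0 : ∀ p q m w → isPath p q 0 (w ++ diag m ∷ []) ≡ false
isPath-diag-k0 p q m w = trans (cong (λ d → validFrom p q 0 0 (w ++ diag m ∷ []) ∧ (d ≡ᵇ 0)) (numDiag-snoc w (diag m)))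
                               (∧-zeroʳ _)

pathsOfLength : (B L p q k : ℕ) → ℕ
pathsOfLength B L p q k = ∑[ v ∈ allVecs L (stepsUpTo B) ] 𝟙 (isPath p q k (toList v))

labels-count : (B t : ℕ) → suc t ≤ B → ∑[ m ∈ upTo (suc B) ] 𝟙 (labelOk t m) ≡ suc t
labels-count B t le = trans (∑-upTo-suc B (𝟙 ∘ labelOk t)) (below B (suc t) le)
  where
  below : ∀ B N → N ≤ B → ∑[ m ∈ upTo B ] 𝟙 (m <ᵇ N) ≡ N
  below B       zero    _          = ∑-zero (upTo B) (λ _ → refl)
  below (suc B) (suc N) (s≤s N≤B) = trans (∑-upTo-suc B (λ m → 𝟙 (m <ᵇ suc N))) (cong suc (below B N N≤B))

pathsOfLength-step : (B L p q k : ℕ) → p + q ≤ B →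
                     pathsOfLength B (suc L) p q k ≡ lastStep (pathsOfLength B L) p q k
pathsOfLength-step B L p q k p+q≤B = begin
  ∑[ v ∈ allVecs (suc L) S ] 𝟙 (isPath p q k (toList v))
    ≡⟨ ∑-allVecs-last L S _ ⟩
  ∑[ x ∈ S ] ∑[ v ∈ allVecs L S ] 𝟙 (isPath p q k (toList (v ∷ʳ x)))
    ≡⟨ ∑-cong S (λ x → ∑-cong (allVecs L S) (λ v → cong (𝟙 ∘ isPath p q k) (Vec.toList-∷ʳ x v))) ⟩
  ending east + (ending north + ∑ (map diag (upTo (suc B))) ending)
    ≡⟨ cong (λ t → ending east + (ending north + t)) (∑-map diag (upTo (suc B)) ending) ⟩
  ending east + (ending north + ∑[ m ∈ upTo (suc B) ] ending (diag m))
    ≡⟨ sym (+-assoc (ending east) _ _) ⟩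
  ending east + ending north + ∑[ m ∈ upTo (suc B) ] ending (diag m)
    ≡⟨ cong₂ _+_ (cong₂ _+_ (ending-east p) (ending-north q)) (ending-diag p q k p+q≤B) ⟩
  lastStep (pathsOfLength B L) p q k ∎
  where
  S = stepsUpTo B
  ending : WStep → ℕ
  ending x = ∑[ v ∈ allVecs L S ] 𝟙 (isPath p q k (toList v ++ x ∷ []))

  ending-east : ∀ p → ∑[ v ∈ allVecs L S ] 𝟙 (isPath p q k (toList v ++ east ∷ [])) ≡ fromEast (pathsOfLength B L) p q k
  ending-east zero    = ∑-zero (allVecs L S) (λ v → cong 𝟙 (isPath-east-0 q k (toList v)))
  ending-east (suc p) = ∑-cong (allVecs L S) (λ v → cong 𝟙 (isPath-east p q k (toList v)))

  ending-north : ∀ q → ∑[ v ∈ allVecs L S ] 𝟙 (isPath p q k (toList v ++ north ∷ [])) ≡ fromNorth (pathsOfLength B L) p q k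
  ending-north zero    = ∑-zero (allVecs L S) (λ v → cong 𝟙 (isPath-north-0 p k (toList v)))
  ending-north (suc q) = ∑-cong (allVecs L S) (λ v → cong 𝟙 (isPath-north p q k (toList v)))

  ending-diag : ∀ p q k → p + q ≤ B →
                ∑[ m ∈ upTo (suc B) ] ∑[ v ∈ allVecs L S ] 𝟙 (isPath p q k (toList v ++ diag m ∷ []))
                  ≡ fromDiag (pathsOfLength B L) p q k
  ending-diag (suc p) (suc q) (suc k) p+q≤B = begin
    ∑[ m ∈ upTo (suc B) ] ∑[ v ∈ allVecs L S ] 𝟙 (isPath (suc p) (suc q) (suc k) (toList v ++ diag m ∷ []))
      ≡⟨ ∑-cong (upTo (suc B)) (λ m → ∑-cong (allVecs L S) (λ v →
           trans (cong 𝟙 (isPath-diag p q k m (toList v))) (𝟙-∧ (labelOk (p + q) m) _))) ⟩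
    ∑[ m ∈ upTo (suc B) ] ∑[ v ∈ allVecs L S ] (𝟙 (labelOk (p + q) m) * 𝟙 (isPath p q k (toList v)))
      ≡⟨ ∑-cong (upTo (suc B)) (λ m → trans (∑-*ˡ (𝟙 (labelOk (p + q) m)) (allVecs L S) _) (*-comm _ P)) ⟩
    ∑[ m ∈ upTo (suc B) ] (P * 𝟙 (labelOk (p + q) m))
      ≡⟨ ∑-*ˡ P (upTo (suc B)) _ ⟩
    P * ∑[ m ∈ upTo (suc B) ] 𝟙 (labelOk (p + q) m)
      ≡⟨ cong (P *_) (labels-count B (p + q) (≤-trans (s≤s (+-monoʳ-≤ p (n≤1+n q))) p+q≤B)) ⟩
    P * suc (p + q)
      ≡⟨ *-comm P (suc (p + q)) ⟩
    suc (p + q) * P ∎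
    where P = pathsOfLength B L p q k
  ending-diag zero q k _ = ∑-zero (upTo (suc B)) (λ m →
    ∑-zero (allVecs L S) (λ v → cong 𝟙 (isPath-diag-p0 q k m (toList v))))
  ending-diag (suc p) zero k _ = ∑-zero (upTo (suc B)) (λ m →
    ∑-zero (allVecs L S) (λ v → cong 𝟙 (isPath-diag-q0 p k m (toList v))))
  ending-diag (suc p) (suc q) zero _ = ∑-zero (upTo (suc B)) (λ m →
    ∑-zero (allVecs L S) (λ v → cong 𝟙 (isPath-diag-k0 (suc p) (suc q) m (toList v))))

-- Weighted (p , q) paths of length L with k diagonal steps, counted by peeling
-- off last steps; summing over L gives a solution of the recurrence.
lengthCount : ℕ → ℕ → ℕ → ℕ → ℕ
lengthCount zero    p q k = 𝟙 (endsAt p q 0 0 ∧ (0 ≡ᵇ k))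
lengthCount (suc L) p q k = lastStep (lengthCount L) p q k

-- With labels up to B ≥ p + q available, the enumerated paths follow the same recursion.
pathsOfLength-as-lengthCount : ∀ B L p q k → p + q ≤ B → pathsOfLength B L p q k ≡ lengthCount L p q k
pathsOfLength-as-lengthCount B zero    p q k _    = +-identityʳ _
pathsOfLength-as-lengthCount B (suc L) p q k p+q≤B = trans (pathsOfLength-step B L p q k p+q≤B)
  (lastStep-cong p q k (λ p′ q′ k′ lt → pathsOfLength-as-lengthCount B L p′ q′ k′ (≤-trans (<⇒≤ lt) p+q≤B)))

lengthCount-long : ∀ L p q k → p + q < L → lengthCount L p q k ≡ 0
lengthCount-long (suc L) p q k p+q<1+L = trans
  (lastStep-cong p q k (λ p′ q′ k′ lt → lengthCount-long L p′ q′ k′ (≤-trans lt (≤-pred p+q<1+L))))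
  (lastStep-zero p q k)

lengthCount-empty : ∀ p q k → 0 < p + q → lengthCount 0 p q k ≡ 0
lengthCount-empty (suc p) q       k _ = refl
lengthCount-empty zero    (suc q) k _ = refl

-- All weighted (p , q) paths with k diagonal steps (their lengths are ≤ p + q).
totalCount : ℕ → ℕ → ℕ → ℕ
totalCount p q k = ∑[ L ∈ upTo (suc (p + q)) ] lengthCount L p q k

totalCount-stable : ∀ N p q k → p + q < N → ∑[ L ∈ upTo N ] lengthCount L p q k ≡ totalCount p q k
totalCount-stable (suc N) p q k p+q<1+N with m≤n⇒m<n∨m≡n (≤-pred p+q<1+N)
... | inj₂ refl    = refl
... | inj₁ p+q<N   = begin
  ∑[ L ∈ upTo (suc N) ] lengthCount L p q k          ≡⟨ ∑-upTo-last N (λ L → lengthCount L p q k) ⟩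
  ∑[ L ∈ upTo N ] lengthCount L p q k + lengthCount N p q k
    ≡⟨ cong₂ _+_ (totalCount-stable N p q k p+q<N) (lengthCount-long N p q k p+q<N) ⟩
  totalCount p q k + 0                               ≡⟨ +-identityʳ _ ⟩
  totalCount p q k                                   ∎

totalCount-solves : SolvesRecurrence totalCount
totalCount-solves = record { initial = initial′ ; step = step′ }
  where
  initial′ : ∀ k → totalCount 0 0 k ≡ 𝟙 (0 ≡ᵇ k)
  initial′ zero    = refl
  initial′ (suc k) = refl

  step′ : ∀ p q k → 0 < p + q → totalCount p q k ≡ lastStep totalCount p q k
  step′ p q k pos = begin
    totalCount p q k
      ≡⟨ ∑-upTo-suc (p + q) (λ L → lengthCount L p q k) ⟩
    lengthCount 0 p q k + ∑[ L ∈ upTo (p + q) ] lastStep (lengthCount L) p q k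
      ≡⟨ cong (_+ ∑[ L ∈ upTo (p + q) ] lastStep (lengthCount L) p q k) (lengthCount-empty p q k pos) ⟩
    ∑[ L ∈ upTo (p + q) ] lastStep (lengthCount L) p q k
      ≡⟨ ∑-lastStep (upTo (p + q)) lengthCount p q k ⟩
    lastStep (λ p′ q′ k′ → ∑[ L ∈ upTo (p + q) ] lengthCount L p′ q′ k′) p q k
      ≡⟨ lastStep-cong p q k (λ p′ q′ k′ → totalCount-stable (p + q) p′ q′ k′) ⟩
    lastStep totalCount p q k ∎

DelannoyPoly-as-totalCount : ∀ p q k → DelannoyPoly p q k ≡ totalCount p q k
DelannoyPoly-as-totalCount p q k = begin
  countᵇ (λ w → numDiag w ≡ᵇ k) (𝒫 p q)
    ≡⟨ countᵇ-as-∑ (λ w → numDiag w ≡ᵇ k) (𝒫 p q) ⟩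
  ∑[ w ∈ 𝒫 p q ] 𝟙 (numDiag w ≡ᵇ k)
    ≡⟨ ∑-filterᵇ (IsWeightedDelannoyᵇ p q) (λ w → numDiag w ≡ᵇ k) (candidatePaths p q) ⟩
  ∑[ w ∈ candidatePaths p q ] 𝟙 (isPath p q k w)
    ≡⟨ ∑-concatMap (λ L → map toList (allVecs L (stepsUpTo (p + q)))) (upTo (suc (p + q))) (𝟙 ∘ isPath p q k) ⟩
  ∑[ L ∈ upTo (suc (p + q)) ] ∑ (map toList (allVecs L (stepsUpTo (p + q)))) (𝟙 ∘ isPath p q k)
    ≡⟨ ∑-cong (upTo (suc (p + q))) (λ L → trans (∑-map toList (allVecs L (stepsUpTo (p + q))) (𝟙 ∘ isPath p q k))
                                                 (pathsOfLength-as-lengthCount (p + q) L p q k ≤-refl)) ⟩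
  totalCount p q k ∎

proposition7p8 : (p q k : ℕ) → A p q k ≡ DelannoyPoly p q k
proposition7p8 p q k = begin
  A p q k                ≡⟨ γ-as-signedCount k p q ⟩
  involutionCount p q k  ≡⟨ recurrence-unique involutionCount-solves totalCount-solves p q k ⟩
  totalCount p q k       ≡⟨ sym (DelannoyPoly-as-totalCount p q k) ⟩
  DelannoyPoly p q k     ∎
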